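{- Let $r\ge 1$, let $\Phi^+$ be the set of positive roots of $\mathfrak{sl}_{r+1}$ (with simple roots $\alpha_1,\dots,\alpha_r$), and let $\mathcal{T}(\infty)$ be the set of marginally large tableaux described in the context. Then, as an identity of formal power series in $z_1,\dots,z_r$ with coefficients in $\mathbb{Z}[t^{ -1}]$, \[ \prod_{\alpha\in\Phi^+} \frac{1-t^{ -1}\bm z^{\alpha}}{1-\bm z^{\alpha}} = \sum_{b\in \mathcal{T}(\infty)} (1-t^{ -1})^{\operatorname{seg}(b)} \bm z^{ -{\rm wt}(b)}. \]
   Context: Tableaux are in English convention (left-justified rows, row lengths weakly decreasing downward). $\mathcal{T}(\infty)$ is the set of tableaux $b$ such that: (1) entries lie in $\{1,2,\dots,r+1\}$; (2) $b$ is semistandard (entries weakly increase along rows, strictly increase down columns) and has exactly $r$ rows; (3) for $1\le j\le r$, the entry in row $j$ of the leftmost column is $j$; (4) $b$ is marginally large: for every $1\le i\le r$, the number of entries equal to $i$ in row $i$ exceeds the total number of boxes in row $i+1$ by exactly one (row $r+1$ being empty). For $2\le k\le r+1$, a $k$-segment of $b$ is a (maximal, necessarily consecutive) run of boxes with entry $k$ in some row $j$ with $1\le j\le k-1$ (the boxes equal to $k$ in row $k$ are not counted); so $\operatorname{seg}_k(b)$, the number of $k$-segments, equals the number of rows $j<k$ of $b$ containing the entry $k$, and $\operatorname{seg}(b)=\sum_{k=2}^{r+1}\operatorname{seg}_k(b)$. The weight of $b$ is defined by $-{\rm wt}(b)=\sum (\alpha_i+\alpha_{i+1}+\cdots+\alpha_{j-1})$,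 the sum running over all boxes of $b$ lying in a row $i$ and having entry $j>i$. For $\beta=\sum_i c_i\alpha_i$ we write $\bm z^{\beta}=\prod_i z_i^{c_i}$; the positive roots are $\alpha_i+\cdots+\alpha_j$ for $1\le i\le j\le r$, and $t$ is an indeterminate. -}

module Defs where

open import Data.Nat using (ℕ; zero; suc; _+_; _*_; _∸_; _≤_; _<_; _≡ᵇ_; _≤ᵇ_)
open import Data.Integer using (ℤ; 0ℤ; 1ℤ; -1ℤ) renaming (_+_ to _+ℤ_; _*_ to _*ℤ_)
open import Data.Bool using (Bool; true; false; if_then_else_; _∧_; _∨_)
open import Data.List using (List; []; _∷_; length; map; upTo; foldr; concatMap; filter)
open import Data.Bool.ListAction using (any)
open import Data.List.Membership.Propositional using (_∈_)
open import Data.Vec using (Vec; []; _∷_; tabulate; replicate; toList)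
open import Data.Vec.Properties using (≡-dec)
open import Data.Fin using (Fin; toℕ)
open import Data.Product using (_×_; _,_)
open import Relation.Binary.PropositionalEquality using (_≡_)
open import Relation.Nullary using (does)
import Data.Nat as N

sumℕ : List ℕ → ℕ
sumℕ = foldr _+_ 0

sumℤ : List ℤ → ℤ
sumℤ = foldr _+ℤ_ 0ℤ

-- Polynomials in s = t⁻¹ over ℤ, as coefficient functions (m ↦ coeff of s^m)

Poly : Set
Poly = ℕ → ℤ

polyOne : Poly
polyOne zero = 1ℤ
polyOne (suc _) = 0ℤ

oneMinusS : Poly
oneMinusS zero = 1ℤ
oneMinusS (suc zero) = -1ℤ
oneMinusS (suc (suc _)) = 0ℤ

polyMul : Poly → Poly → Poly
polyMul f g m = sumℤ (map (λ i → f i *ℤ g (m ∸ i)) (upTo (suc m)))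

polyPow : Poly → ℕ → Poly
polyPow f zero = polyOne
polyPow f (suc n) = polyMul f (polyPow f n)

-- Formal power series in z₁,…,z_r with coefficients in ℤ[t⁻¹]:
-- a series F assigns to an exponent vector c ∈ ℕ^r (monomial z^c)
-- its coefficient F c ∈ ℤ[s], s = t⁻¹.

Series : ℕ → Set
Series r = Vec ℕ r → Poly

splits : ∀ {r} → Vec ℕ r → List (Vec ℕ r × Vec ℕ r)
splits [] = ([] , []) ∷ []
splits (x ∷ xs) =
  concatMap (λ i → map (λ { (a , b) → (i ∷ a , (x ∸ i) ∷ b) }) (splits xs))
            (upTo (suc x))

serMul : ∀ {r} → Series r → Series r → Series r
serMul F G c m = sumℤ (map (λ { (a , b) → polyMul (F a) (G b) m }) (splits c))

serOne : ∀ {r} → Series r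
serOne c = if does (≡-dec N._≟_ c (replicate _ 0)) then polyOne else (λ _ → 0ℤ)

serProd : ∀ {r} → List (Series r) → Series r
serProd = foldr serMul serOne

-- positive roots α_i + … + α_j (1 ≤ i ≤ j ≤ r) as exponent vectors;
-- here 0-based: i ≤ p ≤ j for i,j < r
rootVec : (r i j : ℕ) → Vec ℕ r
rootVec r i j = tabulate (λ p → if (i ≤ᵇ toℕ p) ∧ (toℕ p ≤ᵇ j) then 1 else 0)

posRoots : (r : ℕ) → List (Vec ℕ r)
posRoots r = concatMap (λ i → map (λ k → rootVec r i (i + k)) (upTo (r ∸ i))) (upTo r)

-- numerator 1 - t⁻¹ z^α
numer : ∀ {r} → Vec ℕ r → Series r
numer α c m =
  if does (≡-dec N._≟_ c (replicate _ 0)) then polyOne m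
  else if does (≡-dec N._≟_ c α) then (if m ≡ᵇ 1 then -1ℤ else 0ℤ)
  else 0ℤ

-- 1/(1 - z^α) = Σ_{k≥0} z^{kα}   (α ≠ 0); the exponent c occurs iff c = kα,
-- and then necessarily k ≤ Σ c
geomInv : ∀ {r} → Vec ℕ r → Series r
geomInv α c m =
  if (m ≡ᵇ 0) ∧ any (λ k → does (≡-dec N._≟_ c (Data.Vec.map (k *_) α)))
                    (upTo (suc (sumℕ (toList c))))
  then 1ℤ else 0ℤ

lhsSeries : (r : ℕ) → Series r
lhsSeries r = serProd (map (λ α → serMul (numer α) (geomInv α)) (posRoots r))

-- Tableaux: list of rows (top row first), each row a list of entries
-- read left to right.  Rows are 0-based below: list position i is row i+1.

Tableau : Set
Tableau = List (List ℕ)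

rowAt : Tableau → ℕ → List ℕ
rowAt [] _ = []
rowAt (x ∷ _) zero = x
rowAt (_ ∷ xs) (suc i) = rowAt xs i

at : List ℕ → ℕ → ℕ
at [] _ = 0
at (x ∷ _) zero = x
at (_ ∷ xs) (suc k) = at xs k

countℕ : ℕ → List ℕ → ℕ
countℕ x [] = 0
countℕ x (y ∷ ys) = (if x ≡ᵇ y then 1 else 0) + countℕ x ys

memℕ : ℕ → List ℕ → Bool
memℕ x [] = false
memℕ x (y ∷ ys) = (x ≡ᵇ y) ∨ memℕ x ys

record InTinf (r : ℕ) (b : Tableau) : Set where
  field
    nrows      : length b ≡ r
    entries    : ∀ {row} → row ∈ b → ∀ {x} → x ∈ row → 1 ≤ x × x ≤ suc r
    shape      : ∀ i → suc i < r → length (rowAt b (suc i)) ≤ length (rowAt b i)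
    rowsWeak   : ∀ i → i < r → ∀ k → suc k < length (rowAt b i) →
                 at (rowAt b i) k ≤ at (rowAt b i) (suc k)
    colsStrict : ∀ i → suc i < r → ∀ k → k < length (rowAt b (suc i)) →
                 at (rowAt b i) k < at (rowAt b (suc i)) k
    leftCol    : ∀ i → i < r → 0 < length (rowAt b i) × at (rowAt b i) 0 ≡ suc i
    -- marginally large: #(i in row i) = |row i+1| + 1 (row r+1 empty)
    marginal   : ∀ i → i < r → countℕ (suc i) (rowAt b i) ≡ suc (length (rowAt b (suc i)))

-- -wt(b) as an exponent vector: coefficient of α_{p+1} (p 0-based) counts
-- boxes in row i+1 with entry j such that i+1 ≤ p+1 < j
negWt : (r : ℕ) → Tableau → Vec ℕ r
negWt r b = tabulate λ p → sumℕ (map (λ i → boxes i (toℕ p)) (upTo r))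
  where
  boxes : ℕ → ℕ → ℕ
  boxes i p = if i ≤ᵇ p then length (filter (λ j → suc (suc p) N.≤? j) (rowAt b i)) else 0

seg : ℕ → Tableau → ℕ
seg r b = sumℕ (map (λ q → segk (q + 2)) (upTo r))
  where
  segk : ℕ → ℕ
  segk k = sumℕ (map (λ i → if memℕ k (rowAt b i) then 1 else 0) (upTo (k ∸ 1)))

-- A tableau in 𝒯(∞) is determined by the multiplicities m_{i,k} (1 ≤ i < k ≤ r + 1) of the entry k
-- in row i: row i must consist of |row i+1| + 1 entries i followed by the blocks of larger entries in
-- increasing order, and every family of naturals (m_{i,k}) arises. Matching (i, k) with the positive
-- root α_i + ⋯ + α_{k-1}, one has -wt(b) = Σ m_{i,k} (α_i + ⋯ + α_{k-1}) and seg(b) = #{m_{i,k} ≠ 0}.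
-- On the other side (1 - t⁻¹ z^α) / (1 - z^α) = 1 + Σ_{m ≥ 1} (1 - t⁻¹) z^{mα}, so the coefficient of
-- z^c in the product is the sum of (1 - t⁻¹)^{#{m_α ≠ 0}} over the families (m_α) with Σ m_α α = c,
-- that is, over the tableaux of weight -c.

module Submission where

open import Defs
open import Data.Nat as ℕ using (ℕ; zero; suc; _+_; _*_; _∸_; _≤_; _<_; z≤n; s≤s; _≡ᵇ_; _≤ᵇ_)
import Data.Nat.Properties as ℕP
open import Data.Integer using (ℤ; 0ℤ; 1ℤ; -1ℤ) renaming (_+_ to _+ℤ_; _*_ to _*ℤ_)
import Data.Integer.Properties as ℤP
open import Data.Bool using (Bool; true; false; if_then_else_; _∧_; _∨_; T)
import Data.Bool.Properties as BoolP
open import Data.Bool.ListAction using (any)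
open import Data.List
  using (List; []; _∷_; [_]; _++_; length; map; concat; concatMap; upTo; applyUpTo; replicate; take; drop;
         filter; cartesianProductWith)
import Data.List.Properties as ListP
open import Data.List.Membership.Propositional using (_∈_; find)
open import Data.List.Membership.Propositional.Properties
  using (∈-map⁻; ∈-map⁺; ∈-concat⁻′; ∈-++⁻; ∈-upTo⁻; ∈-upTo⁺; ∈-filter⁻; ∈-filter⁺;
         ∈-cartesianProductWith⁻; ∈-cartesianProductWith⁺)
open import Data.List.Relation.Unary.Any as Any using (here; there)
open import Data.List.Relation.Unary.Any.Properties using (any⁺; any⁻)
open import Data.List.Relation.Unary.All as All using (All; []; _∷_)
import Data.List.Relation.Unary.All.Properties as AllP
open import Data.List.Relation.Unary.AllPairs using (AllPairs; []; _∷_)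
import Data.List.Relation.Unary.AllPairs.Properties as AllPairsP
open import Data.List.Relation.Unary.Unique.Propositional using (Unique)
import Data.List.Relation.Unary.Unique.Propositional.Properties as UniqueP
open import Data.Vec as Vec using (Vec; lookup; toList; zipWith)
import Data.Vec.Properties as VecP
open import Data.Fin as Fin using (Fin; toℕ; fromℕ<)
import Data.Fin.Properties as FinP
open import Data.Product using (Σ; ∃; _×_; _,_; proj₁; proj₂)
open import Data.Sum using (_⊎_; inj₁; inj₂)
open import Data.Unit using (tt)
open import Data.Empty using (⊥-elim)
open import Function using (_∘_; _⇔_; mk⇔)
open import Relation.Nullary using (Dec; does; yes; no; ¬_)
open import Relation.Nullary.Decidable using (dec-true; dec-false; does-⇔)
open import Relation.Binary.PropositionalEquality hiding ([_])
open import Algebra.Properties.CommutativeSemigroup ℤP.+-commutativeSemigroup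
  using () renaming (interchange to +ℤ-interchange)
open import Algebra.Properties.CommutativeSemigroup ℕP.+-commutativeSemigroup
  using () renaming (interchange to +-interchange)
open ≡-Reasoning

when : Bool → ℤ → ℤ
when b v = if b then v else 0ℤ

when-∧ : ∀ a b X → when (a ∧ b) X ≡ when a (when b X)
when-∧ true b X = refl
when-∧ false b X = refl

when-comm : ∀ a b X → when a (when b X) ≡ when b (when a X)
when-comm true b X = refl
when-comm false true X = refl
when-comm false false X = refl

when-+ : ∀ b X Y → when b (X +ℤ Y) ≡ when b X +ℤ when b Y
when-+ true X Y = refl
when-+ false X Y = refl

when-0 : ∀ b → when b 0ℤ ≡ 0ℤ
when-0 true = refl
when-0 false = refl

Σℤ : {A : Set} → List A → (A → ℤ) → ℤ
Σℤ xs f = sumℤ (map f xs)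

module _ {A : Set} where

  Σℤ-cong : (xs : List A) {f g : A → ℤ} → (∀ x → f x ≡ g x) → Σℤ xs f ≡ Σℤ xs g
  Σℤ-cong [] e = refl
  Σℤ-cong (x ∷ xs) e = cong₂ _+ℤ_ (e x) (Σℤ-cong xs e)

  Σℤ-cong∈ : (xs : List A) {f g : A → ℤ} → (∀ x → x ∈ xs → f x ≡ g x) → Σℤ xs f ≡ Σℤ xs g
  Σℤ-cong∈ [] e = refl
  Σℤ-cong∈ (x ∷ xs) e = cong₂ _+ℤ_ (e x (here refl)) (Σℤ-cong∈ xs (λ y p → e y (there p)))

  Σℤ-zero : (xs : List A) {f : A → ℤ} → (∀ x → x ∈ xs → f x ≡ 0ℤ) → Σℤ xs f ≡ 0ℤ
  Σℤ-zero [] e = refl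
  Σℤ-zero (x ∷ xs) e = cong₂ _+ℤ_ (e x (here refl)) (Σℤ-zero xs (λ y p → e y (there p)))

  Σℤ-+ : (xs : List A) (f g : A → ℤ) → Σℤ xs (λ x → f x +ℤ g x) ≡ Σℤ xs f +ℤ Σℤ xs g
  Σℤ-+ [] f g = refl
  Σℤ-+ (x ∷ xs) f g rewrite Σℤ-+ xs f g = +ℤ-interchange (f x) (g x) (Σℤ xs f) (Σℤ xs g)

  Σℤ-when : (xs : List A) (b : Bool) (f : A → ℤ) → Σℤ xs (λ x → when b (f x)) ≡ when b (Σℤ xs f)
  Σℤ-when xs true f = refl
  Σℤ-when xs false f = Σℤ-zero xs (λ _ _ → refl)

  Σℤ-*ˡ : (xs : List A) (a : ℤ) (f : A → ℤ) → Σℤ xs (λ x → a *ℤ f x) ≡ a *ℤ Σℤ xs f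
  Σℤ-*ˡ [] a f = sym (ℤP.*-zeroʳ a)
  Σℤ-*ˡ (x ∷ xs) a f rewrite Σℤ-*ˡ xs a f = sym (ℤP.*-distribˡ-+ a (f x) (Σℤ xs f))

  Σℤ-*ʳ : (xs : List A) (a : ℤ) (f : A → ℤ) → Σℤ xs (λ x → f x *ℤ a) ≡ Σℤ xs f *ℤ a
  Σℤ-*ʳ [] a f = refl
  Σℤ-*ʳ (x ∷ xs) a f rewrite Σℤ-*ʳ xs a f = sym (ℤP.*-distribʳ-+ a (f x) (Σℤ xs f))

  Σℤ-++ : (xs ys : List A) (f : A → ℤ) → Σℤ (xs ++ ys) f ≡ Σℤ xs f +ℤ Σℤ ys f
  Σℤ-++ [] ys f = sym (ℤP.+-identityˡ _)
  Σℤ-++ (x ∷ xs) ys f rewrite Σℤ-++ xs ys f = sym (ℤP.+-assoc (f x) _ _)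

  Σℤ-filter : {P : A → Set} (P? : ∀ x → Dec (P x)) (xs : List A) (f : A → ℤ) →
             Σℤ (filter P? xs) f ≡ Σℤ xs (λ x → when (does (P? x)) (f x))
  Σℤ-filter P? [] f = refl
  Σℤ-filter P? (x ∷ xs) f with does (P? x)
  ... | true = cong (f x +ℤ_) (Σℤ-filter P? xs f)
  ... | false = trans (Σℤ-filter P? xs f) (sym (ℤP.+-identityˡ _))

module _ {A B : Set} where

  Σℤ-map : (xs : List A) (g : A → B) (f : B → ℤ) → Σℤ (map g xs) f ≡ Σℤ xs (f ∘ g)
  Σℤ-map [] g f = refl
  Σℤ-map (x ∷ xs) g f = cong (f (g x) +ℤ_) (Σℤ-map xs g f)

  Σℤ-concatMap : (xs : List A) (g : A → List B) (f : B → ℤ) →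
                Σℤ (concatMap g xs) f ≡ Σℤ xs (λ x → Σℤ (g x) f)
  Σℤ-concatMap [] g f = refl
  Σℤ-concatMap (x ∷ xs) g f =
    trans (Σℤ-++ (g x) (concatMap g xs) f) (cong (Σℤ (g x) f +ℤ_) (Σℤ-concatMap xs g f))

  Σℤ-swap : (xs : List A) (ys : List B) (f : A → B → ℤ) →
           Σℤ xs (λ x → Σℤ ys (f x)) ≡ Σℤ ys (λ y → Σℤ xs (λ x → f x y))
  Σℤ-swap [] ys f = sym (Σℤ-zero ys (λ _ _ → refl))
  Σℤ-swap (x ∷ xs) ys f = trans (cong (Σℤ ys (f x) +ℤ_) (Σℤ-swap xs ys f))
                               (sym (Σℤ-+ ys (f x) (λ y → Σℤ xs (λ x' → f x' y))))

Σℤ-cartesianProductWith : {A B C : Set} (g : A → B → C) (xs : List A) (ys : List B) (f : C → ℤ) →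
  Σℤ (cartesianProductWith g xs ys) f ≡ Σℤ xs (λ x → Σℤ ys (λ y → f (g x y)))
Σℤ-cartesianProductWith g [] ys f = refl
Σℤ-cartesianProductWith g (x ∷ xs) ys f = begin
    Σℤ (map (g x) ys ++ cartesianProductWith g xs ys) f
  ≡⟨ Σℤ-++ (map (g x) ys) _ f ⟩
    Σℤ (map (g x) ys) f +ℤ Σℤ (cartesianProductWith g xs ys) f
  ≡⟨ cong₂ _+ℤ_ (Σℤ-map ys (g x) f) (Σℤ-cartesianProductWith g xs ys f) ⟩
    Σℤ ys (f ∘ g x) +ℤ Σℤ xs (λ x' → Σℤ ys (λ y → f (g x' y))) ∎

range : ℕ → ℕ → List ℕ
range s zero = []
range s (suc k) = s ∷ range (suc s) k

range-snoc : ∀ s k → range s (suc k) ≡ range s k ++ [ s + k ]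
range-snoc s zero = cong [_] (sym (ℕP.+-identityʳ s))
range-snoc s (suc k) =
  cong (s ∷_) (trans (range-snoc (suc s) k) (cong (λ z → range (suc s) k ++ [ z ]) (sym (ℕP.+-suc s k))))

∈-range⁻ : ∀ {i} s k → i ∈ range s k → s ≤ i × i < s + k
∈-range⁻ s (suc k) (here refl) = ℕP.≤-refl , ℕP.m<m+n s (s≤s z≤n)
∈-range⁻ {i} s (suc k) (there m) with ∈-range⁻ (suc s) k m
... | lo , hi = ℕP.<⇒≤ lo , subst (i <_) (sym (ℕP.+-suc s k)) hi

applyUpTo≡range : ∀ {f} s n → (∀ i → f i ≡ s + i) → applyUpTo f n ≡ range s n
applyUpTo≡range s zero e = refl
applyUpTo≡range s (suc n) e =
  cong₂ _∷_ (trans (e 0) (ℕP.+-identityʳ s)) (applyUpTo≡range (suc s) n (λ i → trans (e (suc i)) (ℕP.+-suc s i)))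

upTo≡range : ∀ n → upTo n ≡ range 0 n
upTo≡range n = applyUpTo≡range 0 n (λ _ → refl)

Σℤ-range-shift : ∀ s k (f : ℕ → ℤ) → Σℤ (range (suc s) k) f ≡ Σℤ (range s k) (f ∘ suc)
Σℤ-range-shift s zero f = refl
Σℤ-range-shift s (suc k) f = cong (f (suc s) +ℤ_) (Σℤ-range-shift (suc s) k f)

Σℤ-upTo-rotate : ∀ B (f : ℕ → ℤ) → f 0 ≡ 0ℤ → f (suc B) ≡ 0ℤ →
                Σℤ (upTo (suc B)) (f ∘ suc) ≡ Σℤ (upTo (suc B)) f
Σℤ-upTo-rotate B f f0 fB = begin
    Σℤ (upTo (suc B)) (f ∘ suc)
  ≡⟨ cong (λ l → Σℤ l (f ∘ suc)) (trans (upTo≡range (suc B)) (range-snoc 0 B)) ⟩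
    Σℤ (range 0 B ++ [ B ]) (f ∘ suc)
  ≡⟨ Σℤ-++ (range 0 B) [ B ] (f ∘ suc) ⟩
    Σℤ (range 0 B) (f ∘ suc) +ℤ (f (suc B) +ℤ 0ℤ)
  ≡⟨ cong (λ z → Σℤ (range 0 B) (f ∘ suc) +ℤ (z +ℤ 0ℤ)) fB ⟩
    Σℤ (range 0 B) (f ∘ suc) +ℤ 0ℤ
  ≡⟨ ℤP.+-identityʳ _ ⟩
    Σℤ (range 0 B) (f ∘ suc)
  ≡⟨ sym (Σℤ-range-shift 0 B f) ⟩
    Σℤ (range 1 B) f
  ≡⟨ sym (ℤP.+-identityˡ _) ⟩
    0ℤ +ℤ Σℤ (range 1 B) f
  ≡⟨ cong (_+ℤ Σℤ (range 1 B) f) (sym f0) ⟩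
    Σℤ (range 0 (suc B)) f
  ≡⟨ cong (λ l → Σℤ l f) (sym (upTo≡range (suc B))) ⟩
    Σℤ (upTo (suc B)) f ∎

Σn : {A : Set} → List A → (A → ℕ) → ℕ
Σn xs f = sumℕ (map f xs)

module _ {A : Set} where

  Σn-cong∈ : (xs : List A) {f g : A → ℕ} → (∀ x → x ∈ xs → f x ≡ g x) → Σn xs f ≡ Σn xs g
  Σn-cong∈ [] e = refl
  Σn-cong∈ (x ∷ xs) e = cong₂ _+_ (e x (here refl)) (Σn-cong∈ xs (λ y y∈ → e y (there y∈)))

  Σn-cong : (xs : List A) {f g : A → ℕ} → (∀ x → f x ≡ g x) → Σn xs f ≡ Σn xs g
  Σn-cong xs e = Σn-cong∈ xs (λ x _ → e x)

  Σn-++ : (xs ys : List A) (f : A → ℕ) → Σn (xs ++ ys) f ≡ Σn xs f + Σn ys f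
  Σn-++ [] ys f = refl
  Σn-++ (x ∷ xs) ys f rewrite Σn-++ xs ys f = sym (ℕP.+-assoc (f x) _ _)

  Σn-+ : (xs : List A) (f g : A → ℕ) → Σn xs (λ x → f x + g x) ≡ Σn xs f + Σn xs g
  Σn-+ [] f g = refl
  Σn-+ (x ∷ xs) f g rewrite Σn-+ xs f g = +-interchange (f x) (g x) (Σn xs f) (Σn xs g)

  Σn-zero : (xs : List A) → Σn xs (λ _ → 0) ≡ 0
  Σn-zero [] = refl
  Σn-zero (x ∷ xs) = Σn-zero xs

Σn-range-shift : ∀ s k (f : ℕ → ℕ) → Σn (range (suc s) k) f ≡ Σn (range s k) (f ∘ suc)
Σn-range-shift s zero f = refl
Σn-range-shift s (suc k) f = cong (f (suc s) +_) (Σn-range-shift (suc s) k f)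

_≐_ : Poly → Poly → Set
f ≐ g = ∀ m → f m ≡ g m

negS : Poly
negS k = if k ≡ᵇ 1 then -1ℤ else 0ℤ

polyMul-cong : ∀ {f f' g g'} → f ≐ f' → g ≐ g' → polyMul f g ≐ polyMul f' g'
polyMul-cong e₁ e₂ m = Σℤ-cong (upTo (suc m)) (λ i → cong₂ _*ℤ_ (e₁ i) (e₂ (m ∸ i)))

module _ {A : Set} where

  polyMul-Σˡ : (xs : List A) (F : A → Poly) (g : Poly) (m : ℕ) →
    polyMul (λ k → Σℤ xs (λ x → F x k)) g m ≡ Σℤ xs (λ x → polyMul (F x) g m)
  polyMul-Σˡ xs F g m = trans (Σℤ-cong (upTo (suc m)) (λ i → sym (Σℤ-*ʳ xs (g (m ∸ i)) (λ x → F x i))))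
                              (Σℤ-swap (upTo (suc m)) xs _)

  polyMul-Σʳ : (xs : List A) (f : Poly) (G : A → Poly) (m : ℕ) →
    polyMul f (λ k → Σℤ xs (λ x → G x k)) m ≡ Σℤ xs (λ x → polyMul f (G x) m)
  polyMul-Σʳ xs f G m = trans (Σℤ-cong (upTo (suc m)) (λ i → sym (Σℤ-*ˡ xs (f i) (λ x → G x (m ∸ i)))))
                              (Σℤ-swap (upTo (suc m)) xs _)

polyMul-+ˡ : ∀ f g h m → polyMul (λ k → f k +ℤ g k) h m ≡ polyMul f h m +ℤ polyMul g h m
polyMul-+ˡ f g h m = trans (Σℤ-cong (upTo (suc m)) (λ i → ℤP.*-distribʳ-+ (h (m ∸ i)) (f i) (g i)))
                           (Σℤ-+ (upTo (suc m)) (λ i → f i *ℤ h (m ∸ i)) (λ i → g i *ℤ h (m ∸ i)))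

polyMul-whenˡ : ∀ b f g m → polyMul (λ k → when b (f k)) g m ≡ when b (polyMul f g m)
polyMul-whenˡ true f g m = refl
polyMul-whenˡ false f g m = Σℤ-zero (upTo (suc m)) (λ i _ → ℤP.*-zeroˡ (g (m ∸ i)))

polyMul-whenʳ : ∀ b f g m → polyMul f (λ k → when b (g k)) m ≡ when b (polyMul f g m)
polyMul-whenʳ true f g m = refl
polyMul-whenʳ false f g m = Σℤ-zero (upTo (suc m)) (λ i _ → ℤP.*-zeroʳ (f i))

polyMul-identityˡ : ∀ g → polyMul polyOne g ≐ g
polyMul-identityˡ g m = begin
    Σℤ (upTo (suc m)) (λ i → polyOne i *ℤ g (m ∸ i))
  ≡⟨ cong (λ l → Σℤ l (λ i → polyOne i *ℤ g (m ∸ i))) (upTo≡range (suc m)) ⟩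
    polyOne 0 *ℤ g m +ℤ Σℤ (range 1 m) (λ i → polyOne i *ℤ g (m ∸ i))
  ≡⟨ cong₂ _+ℤ_ (ℤP.*-identityˡ (g m)) (Σℤ-zero (range 1 m) outside) ⟩
    g m +ℤ 0ℤ
  ≡⟨ ℤP.+-identityʳ (g m) ⟩
    g m ∎
  where
  outside : ∀ i → i ∈ range 1 m → polyOne i *ℤ g (m ∸ i) ≡ 0ℤ
  outside zero z∈ with () ← proj₁ (∈-range⁻ 1 m z∈)
  outside (suc i) _ = refl

polyMul-identityʳ : ∀ f → polyMul f polyOne ≐ f
polyMul-identityʳ f m = trans (cong (λ l → Σℤ l (λ i → f i *ℤ polyOne (m ∸ i))) (upTo≡range (suc m)))
                              (diagonal 0 m m refl)
  where
  diagonal : ∀ s k t → t ≡ s + k → Σℤ (range s (suc k)) (λ i → f i *ℤ polyOne (t ∸ i)) ≡ f t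
  diagonal s zero t refl rewrite ℕP.+-identityʳ s | ℕP.n∸n≡0 s =
    trans (ℤP.+-identityʳ _) (ℤP.*-identityʳ (f s))
  diagonal s (suc k) t refl rewrite ℕP.m+n∸m≡n s (suc k) =
    trans (cong₂ _+ℤ_ (ℤP.*-zeroʳ (f s)) (diagonal (suc s) k (s + suc k) (ℕP.+-suc s k)))
          (ℤP.+-identityˡ _)

_≟ᵥ_ : ∀ {r} (u v : Vec ℕ r) → Dec (u ≡ v)
_≟ᵥ_ = VecP.≡-dec ℕ._≟_

vsum : ∀ {r} → Vec ℕ r → ℕ
vsum v = sumℕ (toList v)

scal : ∀ {r} → ℕ → Vec ℕ r → Vec ℕ r
scal n = Vec.map (n *_)

vadd : ∀ {r} → Vec ℕ r → Vec ℕ r → Vec ℕ r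
vadd = zipWith _+_

zeroV : ∀ {r} → Vec ℕ r
zeroV = Vec.replicate _ 0

vsum-vadd : ∀ {r} (u v : Vec ℕ r) → vsum (vadd u v) ≡ vsum u + vsum v
vsum-vadd Vec.[] Vec.[] = refl
vsum-vadd (x Vec.∷ u) (y Vec.∷ v) rewrite vsum-vadd u v = +-interchange x y (vsum u) (vsum v)

vsum-scal : ∀ {r} n (v : Vec ℕ r) → vsum (scal n v) ≡ n * vsum v
vsum-scal n Vec.[] = sym (ℕP.*-zeroʳ n)
vsum-scal n (x Vec.∷ v) rewrite vsum-scal n v = sym (ℕP.*-distribˡ-+ n x (vsum v))

vsum-zeroV : ∀ r → vsum (zeroV {r}) ≡ 0
vsum-zeroV zero = refl
vsum-zeroV (suc r) = vsum-zeroV r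

vadd-identityˡ : ∀ {r} (v : Vec ℕ r) → vadd zeroV v ≡ v
vadd-identityˡ Vec.[] = refl
vadd-identityˡ (x Vec.∷ v) = cong (x Vec.∷_) (vadd-identityˡ v)

vadd-scal-suc : ∀ {r} j (α : Vec ℕ r) → vadd α (scal j α) ≡ scal (suc j) α
vadd-scal-suc j Vec.[] = refl
vadd-scal-suc j (x Vec.∷ α) = cong (_ Vec.∷_) (vadd-scal-suc j α)

≤-vsum-vadd : ∀ {r} (u v : Vec ℕ r) → vsum u ≤ vsum (vadd u v) × vsum v ≤ vsum (vadd u v)
≤-vsum-vadd u v rewrite vsum-vadd u v = ℕP.m≤m+n (vsum u) (vsum v) , ℕP.m≤n+m (vsum v) (vsum u)

module NonzeroVector {r} (α : Vec ℕ r) (nz : 1 ≤ vsum α) where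

  private instance
    vsum-nonZero : ℕ.NonZero (vsum α)
    vsum-nonZero = ℕ.>-nonZero nz

  scal-injective : ∀ {j k} → scal j α ≡ scal k α → j ≡ k
  scal-injective {j} {k} e =
    ℕP.*-cancelʳ-≡ j k (vsum α) (trans (sym (vsum-scal j α)) (trans (cong vsum e) (vsum-scal k α)))

  ≤-vsum-scal : ∀ j → j ≤ vsum (scal j α)
  ≤-vsum-scal j rewrite vsum-scal j α = ℕP.m≤m*n j (vsum α)

  zeroV≢ : zeroV ≢ α
  zeroV≢ e = ℕP.<⇒≢ nz (sym (trans (cong vsum (sym e)) (vsum-zeroV r)))

splits-sound : ∀ {r} (c : Vec ℕ r) {p} → p ∈ splits c → vadd (proj₁ p) (proj₂ p) ≡ c
splits-sound Vec.[] (here refl) = refl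
splits-sound (x Vec.∷ c) {p} p∈ with ∈-concat⁻′ (map _ (upTo (suc x))) p∈
... | ys , p∈ys , ys∈ with ∈-map⁻ _ ys∈
... | i , i∈ , refl with ∈-map⁻ _ p∈ys
... | (a , b) , ab∈ , refl = cong₂ Vec._∷_ (ℕP.m+[n∸m]≡n (ℕP.≤-pred (∈-upTo⁻ i∈))) (splits-sound c ab∈)

splits-bounded : ∀ {r} (c : Vec ℕ r) {p} → p ∈ splits c → vsum (proj₁ p) ≤ vsum c × vsum (proj₂ p) ≤ vsum c
splits-bounded c {a , b} p∈ = subst (λ v → vsum a ≤ vsum v × vsum b ≤ vsum v) (splits-sound c p∈) (≤-vsum-vadd a b)

Σℤ-δ-outside : ∀ s k u (Z : ℕ → ℤ) → u < s ⊎ s + k ≤ u →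
               Σℤ (range s k) (λ i → when (does (i ℕ.≟ u)) (Z i)) ≡ 0ℤ
Σℤ-δ-outside s k u Z out =
  Σℤ-zero (range s k) (λ i i∈ → cong (λ b → when b (Z i)) (dec-false (i ℕ.≟ u) (≢u i∈ out)))
  where
  ≢u : ∀ {i} → i ∈ range s k → u < s ⊎ s + k ≤ u → i ≢ u
  ≢u i∈ (inj₁ u<s) refl = ℕP.<⇒≱ u<s (proj₁ (∈-range⁻ s k i∈))
  ≢u i∈ (inj₂ s+k≤u) refl = ℕP.<⇒≱ (proj₂ (∈-range⁻ s k i∈)) s+k≤u

Σℤ-δ-inside : ∀ s k u (Z : ℕ → ℤ) → s ≤ u → u < s + k →
              Σℤ (range s k) (λ i → when (does (i ℕ.≟ u)) (Z i)) ≡ Z u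
Σℤ-δ-inside s zero u Z s≤u u<s+0 = ⊥-elim (ℕP.<⇒≱ u<s+0 (subst (_≤ u) (sym (ℕP.+-identityʳ s)) s≤u))
Σℤ-δ-inside s (suc k) u Z s≤u u<s+k with s ℕ.≟ u
... | yes refl = trans (cong₂ _+ℤ_ (cong (λ d → when d (Z s)) (dec-true (s ℕ.≟ s) refl))
                                  (Σℤ-δ-outside (suc s) k s Z (inj₁ (ℕP.n<1+n s))))
                       (ℤP.+-identityʳ _)
... | no s≢u = trans (cong₂ _+ℤ_ (cong (λ d → when d (Z s)) (dec-false (s ℕ.≟ u) s≢u))
                                (Σℤ-δ-inside (suc s) k u Z (ℕP.≤∧≢⇒< s≤u s≢u) (subst (u <_) (ℕP.+-suc s k) u<s+k)))
                     (ℤP.+-identityˡ _)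

Σℤ-antidiagonal-δ : ∀ x a b Y →
  Σℤ (upTo (suc x)) (λ i → when (does (i ℕ.≟ a)) (when (does (x ∸ i ℕ.≟ b)) Y)) ≡ when (does (x ℕ.≟ a + b)) Y
Σℤ-antidiagonal-δ x a b Y = trans (cong (λ l → Σℤ l F) (upTo≡range (suc x))) (by-cases (a ℕ.≤? x))
  where
  F : ℕ → ℤ
  F i = when (does (i ℕ.≟ a)) (when (does (x ∸ i ℕ.≟ b)) Y)
  by-cases : Dec (a ≤ x) → Σℤ (range 0 (suc x)) F ≡ when (does (x ℕ.≟ a + b)) Y
  by-cases (yes a≤x) = trans (Σℤ-δ-inside 0 (suc x) a (λ i → when (does (x ∸ i ℕ.≟ b)) Y) z≤n (s≤s a≤x))
    (cong (λ d → when d Y) (does-⇔ (mk⇔ (λ e → trans (sym (ℕP.m+[n∸m]≡n a≤x)) (cong (a +_) e))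
                                        (λ e → trans (cong (_∸ a) e) (ℕP.m+n∸m≡n a b)))
                                   (x ∸ a ℕ.≟ b) (x ℕ.≟ a + b)))
  by-cases (no a≰x) = trans (Σℤ-δ-outside 0 (suc x) a _ (inj₂ (ℕP.≰⇒> a≰x)))
    (cong (λ d → when d Y) (sym (dec-false (x ℕ.≟ a + b) (λ e → a≰x (subst (a ≤_) (sym e) (ℕP.m≤m+n a b))))))

Σℤ-splits-δ : ∀ {r} (c u v : Vec ℕ r) (X : ℤ) →
  Σℤ (splits c) (λ p → when (does (proj₁ p ≟ᵥ u)) (when (does (proj₂ p ≟ᵥ v)) X)) ≡ when (does (c ≟ᵥ vadd u v)) X
Σℤ-splits-δ Vec.[] Vec.[] Vec.[] X = ℤP.+-identityʳ X
Σℤ-splits-δ (x Vec.∷ c) (a Vec.∷ u) (b Vec.∷ v) X = begin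
    Σℤ (splits (x Vec.∷ c)) δ
  ≡⟨ Σℤ-concatMap (upTo (suc x)) (λ i → map (cons i) (splits c)) δ ⟩
    Σℤ (upTo (suc x)) (λ i → Σℤ (map (cons i) (splits c)) δ)
  ≡⟨ Σℤ-cong (upTo (suc x)) (λ i → trans (Σℤ-map (splits c) (cons i) δ) (Σℤ-cong (splits c) (separate i))) ⟩
    Σℤ (upTo (suc x)) (λ i → Σℤ (splits c) (λ p → when (δa i) (when (δb (x ∸ i)) (δ′ p))))
  ≡⟨ Σℤ-cong (upTo (suc x)) (λ i → trans (Σℤ-when (splits c) (δa i) _)
                                        (cong (when (δa i)) (Σℤ-when (splits c) (δb (x ∸ i)) _))) ⟩
    Σℤ (upTo (suc x)) (λ i → when (δa i) (when (δb (x ∸ i)) (Σℤ (splits c) δ′)))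
  ≡⟨ Σℤ-cong (upTo (suc x)) (λ i → cong (λ z → when (δa i) (when (δb (x ∸ i)) z)) (Σℤ-splits-δ c u v X)) ⟩
    Σℤ (upTo (suc x)) (λ i → when (δa i) (when (δb (x ∸ i)) (when (does (c ≟ᵥ vadd u v)) X)))
  ≡⟨ Σℤ-antidiagonal-δ x a b _ ⟩
    when (does (x ℕ.≟ a + b)) (when (does (c ≟ᵥ vadd u v)) X)
  ≡⟨ sym (when-∧ (does (x ℕ.≟ a + b)) _ X) ⟩
    when (does ((x Vec.∷ c) ≟ᵥ vadd (a Vec.∷ u) (b Vec.∷ v))) X ∎
  where
  δa : ℕ → Bool
  δa i = does (i ℕ.≟ a)
  δb : ℕ → Bool
  δb j = does (j ℕ.≟ b)
  cons : ℕ → Vec ℕ _ × Vec ℕ _ → Vec ℕ _ × Vec ℕ _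
  cons i (a′ , b′) = (i Vec.∷ a′ , (x ∸ i) Vec.∷ b′)
  δ : Vec ℕ _ × Vec ℕ _ → ℤ
  δ (a′ , b′) = when (does (a′ ≟ᵥ (a Vec.∷ u))) (when (does (b′ ≟ᵥ (b Vec.∷ v))) X)
  δ′ : Vec ℕ _ × Vec ℕ _ → ℤ
  δ′ (a′ , b′) = when (does (a′ ≟ᵥ u)) (when (does (b′ ≟ᵥ v)) X)
  separate : ∀ i p → δ (cons i p) ≡ when (δa i) (when (δb (x ∸ i)) (δ′ p))
  separate i (a′ , b′)
    rewrite when-∧ (δa i) (does (a′ ≟ᵥ u)) (when ((δb (x ∸ i)) ∧ does (b′ ≟ᵥ v)) X)
          | when-∧ (δb (x ∸ i)) (does (b′ ≟ᵥ v)) X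
          = cong (when (δa i)) (when-comm (does (a′ ≟ᵥ u)) (δb (x ∸ i)) _)

-- One factor: (1 - s z^α) / (1 - z^α) = 1 + Σ_{n ≥ 1} (1 - s) z^{nα}

rootCoeff : ℕ → Poly
rootCoeff zero = polyOne
rootCoeff (suc _) = oneMinusS

rootCoeff-excess : ℕ → Poly
rootCoeff-excess zero _ = 0ℤ
rootCoeff-excess (suc _) = negS

rootCoeff-split : ∀ n → rootCoeff n ≐ λ k → polyOne k +ℤ rootCoeff-excess n k
rootCoeff-split zero k = sym (ℤP.+-identityʳ _)
rootCoeff-split (suc n) zero = refl
rootCoeff-split (suc n) (suc zero) = refl
rootCoeff-split (suc n) (suc (suc k)) = refl

T-does⇒ : {P : Set} (P? : Dec P) → T (does P?) → P
T-does⇒ (yes p) _ = p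

rootFactor : ∀ {r} → Vec ℕ r → Series r
rootFactor α = serMul (numer α) (geomInv α)

module RootFactor {r} (α : Vec ℕ r) (nz : 1 ≤ vsum α) where
  open NonzeroVector α nz

  numer-split : ∀ x → numer α x ≐ λ k → when (does (x ≟ᵥ zeroV)) (polyOne k) +ℤ when (does (x ≟ᵥ α)) (negS k)
  numer-split x k with x ≟ᵥ zeroV | x ≟ᵥ α
  ... | yes x≡0 | yes x≡α = ⊥-elim (zeroV≢ (trans (sym x≡0) x≡α))
  ... | yes _ | no _ = sym (ℤP.+-identityʳ _)
  ... | no _ | yes _ = sym (ℤP.+-identityˡ _)
  ... | no _ | no _ = refl

  geomInv-split : ∀ B y → vsum y ≤ B →
    geomInv α y ≐ λ k → Σℤ (upTo (suc B)) (λ j → when (does (y ≟ᵥ scal j α)) (polyOne k))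
  geomInv-split B y y≤B k with any (λ j → does (y ≟ᵥ scal j α)) (upTo (suc (vsum y))) in multiple
  ... | true with find (any⁻ _ (upTo (suc (vsum y))) (subst T (sym multiple) tt))
  ...   | j₀ , j₀∈ , y≡j₀α = sym (begin
      Σℤ (upTo (suc B)) (λ j → when (does (y ≟ᵥ scal j α)) (polyOne k))
    ≡⟨ Σℤ-cong (upTo (suc B)) (λ j →
         cong (λ d → when d (polyOne k)) (does-⇔ (same-multiple j) (y ≟ᵥ scal j α) (j ℕ.≟ j₀))) ⟩
      Σℤ (upTo (suc B)) (λ j → when (does (j ℕ.≟ j₀)) (polyOne k))
    ≡⟨ cong (λ l → Σℤ l (λ j → when (does (j ℕ.≟ j₀)) (polyOne k))) (upTo≡range (suc B)) ⟩
      Σℤ (range 0 (suc B)) (λ j → when (does (j ℕ.≟ j₀)) (polyOne k))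
    ≡⟨ Σℤ-δ-inside 0 (suc B) j₀ (λ _ → polyOne k) z≤n (s≤s (ℕP.≤-trans (ℕP.≤-pred (∈-upTo⁻ j₀∈)) y≤B)) ⟩
      polyOne k
    ≡⟨ polyOne≡ k ⟩
      (if (k ≡ᵇ 0) ∧ true then 1ℤ else 0ℤ) ∎)
    where
    y≡ : y ≡ scal j₀ α
    y≡ = T-does⇒ (y ≟ᵥ scal j₀ α) y≡j₀α
    same-multiple : ∀ j → (y ≡ scal j α) ⇔ (j ≡ j₀)
    same-multiple j = mk⇔ (λ e → scal-injective (trans (sym e) y≡)) (λ { refl → y≡ })
    polyOne≡ : ∀ k → polyOne k ≡ (if (k ≡ᵇ 0) ∧ true then 1ℤ else 0ℤ)
    polyOne≡ zero = refl
    polyOne≡ (suc k) = refl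
  geomInv-split B y y≤B k | false =
    trans (cong (λ b → if b then 1ℤ else 0ℤ) (BoolP.∧-zeroʳ (k ≡ᵇ 0)))
          (sym (Σℤ-zero (upTo (suc B)) (λ j _ →
                  cong (λ d → when d (polyOne k)) (dec-false (y ≟ᵥ scal j α) (not-multiple j)))))
    where
    not-multiple : ∀ j → y ≢ scal j α
    not-multiple j e with j ℕ.≤? vsum y
    ... | yes j≤ = subst T multiple (any⁺ _ (Any.map (λ { refl → subst T (sym (dec-true (y ≟ᵥ scal j α) e)) tt })
                                       (∈-upTo⁺ (s≤s j≤))))
    ... | no j≰ = j≰ (subst (j ≤_) (cong vsum (sym e)) (≤-vsum-scal j))

  private
    polyMul-when-Σδ : ∀ B f e (δ : ℕ → Bool) m →
      polyMul (λ k → when e (f k)) (λ k → Σℤ (upTo (suc B)) (λ j → when (δ j) (polyOne k))) m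
      ≡ Σℤ (upTo (suc B)) (λ j → when e (when (δ j) (f m)))
    polyMul-when-Σδ B f e δ m = begin
        polyMul (λ k → when e (f k)) (λ k → Σℤ UB (λ j → when (δ j) (polyOne k))) m
      ≡⟨ polyMul-whenˡ e f (λ k → Σℤ UB (λ j → when (δ j) (polyOne k))) m ⟩
        when e (polyMul f (λ k → Σℤ UB (λ j → when (δ j) (polyOne k))) m)
      ≡⟨ cong (when e) (polyMul-Σʳ UB f (λ j k → when (δ j) (polyOne k)) m) ⟩
        when e (Σℤ UB (λ j → polyMul f (λ k → when (δ j) (polyOne k)) m))
      ≡⟨ cong (when e) (Σℤ-cong UB (λ j → trans (polyMul-whenʳ (δ j) f polyOne m)
                                               (cong (when (δ j)) (polyMul-identityʳ f m)))) ⟩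
        when e (Σℤ UB (λ j → when (δ j) (f m)))
      ≡⟨ sym (Σℤ-when UB e (λ j → when (δ j) (f m))) ⟩
        Σℤ UB (λ j → when e (when (δ j) (f m))) ∎
      where UB = upTo (suc B)

  rootFactor-coeff : ∀ B a → vsum a ≤ B →
    rootFactor α a ≐ λ m → Σℤ (upTo (suc B)) (λ n → when (does (a ≟ᵥ scal n α)) (rootCoeff n m))
  rootFactor-coeff B a a≤B m = begin
      Σℤ (splits a) (λ p → polyMul (numer α (proj₁ p)) (geomInv α (proj₂ p)) m)
    ≡⟨ Σℤ-cong∈ (splits a) (λ p p∈ → expand p (ℕP.≤-trans (proj₂ (splits-bounded a p∈)) a≤B)) ⟩
      Σℤ (splits a) (λ p → T₀ p +ℤ T₁ p)
    ≡⟨ Σℤ-+ (splits a) T₀ T₁ ⟩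
      Σℤ (splits a) T₀ +ℤ Σℤ (splits a) T₁
    ≡⟨ cong₂ _+ℤ_ (Σℤ-swap (splits a) UB _) (Σℤ-swap (splits a) UB _) ⟩
      Σℤ UB (λ j → Σℤ (splits a) (λ p → when (does (proj₁ p ≟ᵥ zeroV)) (when (does (proj₂ p ≟ᵥ scal j α)) (polyOne m))))
      +ℤ Σℤ UB (λ j → Σℤ (splits a) (λ p → when (does (proj₁ p ≟ᵥ α)) (when (does (proj₂ p ≟ᵥ scal j α)) (negS m))))
    ≡⟨ cong₂ _+ℤ_
         (Σℤ-cong UB (λ j → trans (Σℤ-splits-δ a zeroV (scal j α) (polyOne m))
                                 (cong (λ v → when (does (a ≟ᵥ v)) (polyOne m)) (vadd-identityˡ (scal j α)))))
         (Σℤ-cong UB (λ j → trans (Σℤ-splits-δ a α (scal j α) (negS m))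
                                 (cong (λ v → when (does (a ≟ᵥ v)) (negS m)) (vadd-scal-suc j α)))) ⟩
      Σℤ UB (λ n → when (a≡ n) (polyOne m)) +ℤ Σℤ UB (excess ∘ suc)
    ≡⟨ cong (Σℤ UB (λ n → when (a≡ n) (polyOne m)) +ℤ_) (Σℤ-upTo-rotate B excess (when-0 (a≡ 0)) excess-beyond) ⟩
      Σℤ UB (λ n → when (a≡ n) (polyOne m)) +ℤ Σℤ UB excess
    ≡⟨ sym (Σℤ-+ UB (λ n → when (a≡ n) (polyOne m)) excess) ⟩
      Σℤ UB (λ n → when (a≡ n) (polyOne m) +ℤ excess n)
    ≡⟨ Σℤ-cong UB (λ n → trans (sym (when-+ (a≡ n) (polyOne m) (rootCoeff-excess n m)))
                              (cong (when (a≡ n)) (sym (rootCoeff-split n m)))) ⟩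
      Σℤ UB (λ n → when (a≡ n) (rootCoeff n m)) ∎
    where
    UB = upTo (suc B)
    a≡ : ℕ → Bool
    a≡ n = does (a ≟ᵥ scal n α)
    excess : ℕ → ℤ
    excess n = when (a≡ n) (rootCoeff-excess n m)
    excess-beyond : excess (suc B) ≡ 0ℤ
    excess-beyond = cong (λ d → when d (negS m)) (dec-false (a ≟ᵥ scal (suc B) α)
      (λ e → ℕP.<⇒≱ (s≤s a≤B) (subst (suc B ≤_) (cong vsum (sym e)) (≤-vsum-scal (suc B)))))
    T₀ T₁ : Vec ℕ r × Vec ℕ r → ℤ
    T₀ (x , y) = Σℤ UB (λ j → when (does (x ≟ᵥ zeroV)) (when (does (y ≟ᵥ scal j α)) (polyOne m)))
    T₁ (x , y) = Σℤ UB (λ j → when (does (x ≟ᵥ α)) (when (does (y ≟ᵥ scal j α)) (negS m)))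
    expand : ∀ p → vsum (proj₂ p) ≤ B → polyMul (numer α (proj₁ p)) (geomInv α (proj₂ p)) m ≡ T₀ p +ℤ T₁ p
    expand (x , y) y≤B = begin
        polyMul (numer α x) (geomInv α y) m
      ≡⟨ polyMul-cong (numer-split x) (geomInv-split B y y≤B) m ⟩
        polyMul (λ k → when (does (x ≟ᵥ zeroV)) (polyOne k) +ℤ when (does (x ≟ᵥ α)) (negS k)) geom m
      ≡⟨ polyMul-+ˡ (λ k → when (does (x ≟ᵥ zeroV)) (polyOne k)) (λ k → when (does (x ≟ᵥ α)) (negS k)) geom m ⟩
        polyMul (λ k → when (does (x ≟ᵥ zeroV)) (polyOne k)) geom m
        +ℤ polyMul (λ k → when (does (x ≟ᵥ α)) (negS k)) geom m
      ≡⟨ cong₂ _+ℤ_ (polyMul-when-Σδ B polyOne (does (x ≟ᵥ zeroV)) (λ j → does (y ≟ᵥ scal j α)) m)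
                    (polyMul-when-Σδ B negS (does (x ≟ᵥ α)) (λ j → does (y ≟ᵥ scal j α)) m) ⟩
        T₀ (x , y) +ℤ T₁ (x , y) ∎
      where
      geom : Poly
      geom k = Σℤ UB (λ j → when (does (y ≟ᵥ scal j α)) (polyOne k))

linComb : ∀ {r} → List ℕ → List (Vec ℕ r) → Vec ℕ r
linComb (n ∷ ns) (α ∷ αs) = vadd (scal n α) (linComb ns αs)
linComb _ _ = zeroV

rootCoeffProd : List ℕ → Poly
rootCoeffProd [] = polyOne
rootCoeffProd (n ∷ ns) = polyMul (rootCoeff n) (rootCoeffProd ns)

box : ℕ → ℕ → List (List ℕ)
box B zero = [ [] ]
box B (suc N) = cartesianProductWith _∷_ (upTo (suc B)) (box B N)

serOne-split : ∀ {r} (c : Vec ℕ r) → serOne c ≐ λ m → when (does (c ≟ᵥ zeroV)) (polyOne m)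
serOne-split c m with does (c ≟ᵥ zeroV)
... | true = refl
... | false = refl

serProd-rootFactors : ∀ {r} (αs : List (Vec ℕ r)) → All (λ α → 1 ≤ vsum α) αs →
  ∀ B (c : Vec ℕ r) → vsum c ≤ B →
  serProd (map rootFactor αs) c
  ≐ λ m → Σℤ (box B (length αs)) (λ ns → when (does (c ≟ᵥ linComb ns αs)) (rootCoeffProd ns m))
serProd-rootFactors [] [] B c c≤B m = trans (serOne-split c m) (sym (ℤP.+-identityʳ _))
serProd-rootFactors {r} (α ∷ αs) (nz ∷ nzs) B c c≤B m = begin
    Σℤ (splits c) (λ p → polyMul (rootFactor α (proj₁ p)) (rest (proj₂ p)) m)
  ≡⟨ Σℤ-cong∈ (splits c) (λ p p∈ → let (x≤c , y≤c) = splits-bounded c p∈ in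
                                    expand p (ℕP.≤-trans x≤c c≤B) (ℕP.≤-trans y≤c c≤B)) ⟩
    Σℤ (splits c) (λ p → Σℤ UB (λ n → Σℤ BX (λ ns → δ p n ns)))
  ≡⟨ Σℤ-swap (splits c) UB _ ⟩
    Σℤ UB (λ n → Σℤ (splits c) (λ p → Σℤ BX (λ ns → δ p n ns)))
  ≡⟨ Σℤ-cong UB (λ n → Σℤ-swap (splits c) BX _) ⟩
    Σℤ UB (λ n → Σℤ BX (λ ns → Σℤ (splits c) (λ p → δ p n ns)))
  ≡⟨ Σℤ-cong UB (λ n → Σℤ-cong BX (λ ns → Σℤ-splits-δ c (scal n α) (linComb ns αs) (X n ns))) ⟩
    Σℤ UB (λ n → Σℤ BX (λ ns → F (n ∷ ns)))
  ≡⟨ sym (Σℤ-cartesianProductWith _∷_ UB BX F) ⟩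
    Σℤ (box B (suc (length αs))) F ∎
  where
  open RootFactor α nz using (rootFactor-coeff)
  UB = upTo (suc B)
  BX = box B (length αs)
  rest = serProd (map rootFactor αs)
  X : ℕ → List ℕ → ℤ
  X n ns = polyMul (rootCoeff n) (rootCoeffProd ns) m
  δ : Vec ℕ r × Vec ℕ r → ℕ → List ℕ → ℤ
  δ (x , y) n ns = when (does (x ≟ᵥ scal n α)) (when (does (y ≟ᵥ linComb ns αs)) (X n ns))
  F : List ℕ → ℤ
  F ns = when (does (c ≟ᵥ linComb ns (α ∷ αs))) (rootCoeffProd ns m)
  expand : ∀ p → vsum (proj₁ p) ≤ B → vsum (proj₂ p) ≤ B →
    polyMul (rootFactor α (proj₁ p)) (rest (proj₂ p)) m ≡ Σℤ UB (λ n → Σℤ BX (λ ns → δ p n ns))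
  expand (x , y) x≤B y≤B = begin
      polyMul (rootFactor α x) (rest y) m
    ≡⟨ polyMul-cong (rootFactor-coeff B x x≤B) (serProd-rootFactors αs nzs B y y≤B) m ⟩
      polyMul (λ k → Σℤ UB (λ n → when (x≡ n) (rootCoeff n k))) Q m
    ≡⟨ polyMul-Σˡ UB (λ n k → when (x≡ n) (rootCoeff n k)) Q m ⟩
      Σℤ UB (λ n → polyMul (λ k → when (x≡ n) (rootCoeff n k)) Q m)
    ≡⟨ Σℤ-cong UB (λ n → polyMul-whenˡ (x≡ n) (rootCoeff n) Q m) ⟩
      Σℤ UB (λ n → when (x≡ n) (polyMul (rootCoeff n) Q m))
    ≡⟨ Σℤ-cong UB (λ n → cong (when (x≡ n)) (polyMul-Σʳ BX (rootCoeff n) (λ ns k → when (y≡ ns) (rootCoeffProd ns k)) m)) ⟩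
      Σℤ UB (λ n → when (x≡ n) (Σℤ BX (λ ns → polyMul (rootCoeff n) (λ k → when (y≡ ns) (rootCoeffProd ns k)) m)))
    ≡⟨ Σℤ-cong UB (λ n → cong (when (x≡ n)) (Σℤ-cong BX (λ ns →
         polyMul-whenʳ (y≡ ns) (rootCoeff n) (rootCoeffProd ns) m))) ⟩
      Σℤ UB (λ n → when (x≡ n) (Σℤ BX (λ ns → when (y≡ ns) (X n ns))))
    ≡⟨ Σℤ-cong UB (λ n → sym (Σℤ-when BX (x≡ n) (λ ns → when (y≡ ns) (X n ns)))) ⟩
      Σℤ UB (λ n → Σℤ BX (λ ns → δ (x , y) n ns)) ∎
    where
    x≡ : ℕ → Bool
    x≡ n = does (x ≟ᵥ scal n α)
    y≡ : List ℕ → Bool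
    y≡ ns = does (y ≟ᵥ linComb ns αs)
    Q : Poly
    Q k = Σℤ BX (λ ns → when (y≡ ns) (rootCoeffProd ns k))

nonzeros : List ℕ → ℕ
nonzeros [] = 0
nonzeros (zero ∷ ns) = nonzeros ns
nonzeros (suc _ ∷ ns) = suc (nonzeros ns)

rootCoeffProd≐pow : ∀ ns → rootCoeffProd ns ≐ polyPow oneMinusS (nonzeros ns)
rootCoeffProd≐pow [] m = refl
rootCoeffProd≐pow (zero ∷ ns) m = trans (polyMul-identityˡ (rootCoeffProd ns) m) (rootCoeffProd≐pow ns m)
rootCoeffProd≐pow (suc n ∷ ns) m = polyMul-cong {oneMinusS} (λ _ → refl) (rootCoeffProd≐pow ns) m

nonzeros-take-drop : ∀ k ns → nonzeros (take k ns) + nonzeros (drop k ns) ≡ nonzeros ns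
nonzeros-take-drop zero ns = refl
nonzeros-take-drop (suc k) [] = refl
nonzeros-take-drop (suc k) (zero ∷ ns) = nonzeros-take-drop k ns
nonzeros-take-drop (suc k) (suc _ ∷ ns) = cong suc (nonzeros-take-drop k ns)

Sorted : List ℕ → Set
Sorted = AllPairs _≤_

≡ᵇ-refl : ∀ x → (x ≡ᵇ x) ≡ true
≡ᵇ-refl x = dec-true (x ℕ.≟ x) refl

≢⇒≡ᵇ-false : ∀ {x y} → x ≢ y → (x ≡ᵇ y) ≡ false
≢⇒≡ᵇ-false {x} {y} = dec-false (x ℕ.≟ y)

∈-replicate⁻ : ∀ {x y : ℕ} n → x ∈ replicate n y → x ≡ y
∈-replicate⁻ (suc n) (here refl) = refl
∈-replicate⁻ (suc n) (there x∈) = ∈-replicate⁻ n x∈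

replicate-sorted : ∀ n y → Sorted (replicate n y)
replicate-sorted zero y = []
replicate-sorted (suc n) y = AllP.replicate⁺ n ℕP.≤-refl ∷ replicate-sorted n y

sorted-at : ∀ {xs} → Sorted xs → ∀ k → suc k < length xs → at xs k ≤ at xs (suc k)
sorted-at ((x≤y ∷ _) ∷ _ ∷ _) zero _ = x≤y
sorted-at (_ ∷ sorted) (suc k) (s≤s k<) = sorted-at sorted k k<

at-sorted : ∀ xs → (∀ k → suc k < length xs → at xs k ≤ at xs (suc k)) → Sorted xs
at-sorted [] _ = []
at-sorted (x ∷ []) _ = [] ∷ []
at-sorted (x ∷ y ∷ ys) adjacent with at-sorted (y ∷ ys) (λ k k< → adjacent (suc k) (s≤s k<))
... | y≤ys ∷ sorted = (x≤y ∷ All.map (ℕP.≤-trans x≤y) y≤ys) ∷ y≤ys ∷ sorted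
  where x≤y = adjacent 0 (s≤s (s≤s z≤n))

at-++ˡ : ∀ xs ys k → k < length xs → at (xs ++ ys) k ≡ at xs k
at-++ˡ (x ∷ xs) ys zero _ = refl
at-++ˡ (x ∷ xs) ys (suc k) (s≤s k<) = at-++ˡ xs ys k k<

at-replicate : ∀ n y k → k < n → at (replicate n y) k ≡ y
at-replicate (suc n) y zero _ = refl
at-replicate (suc n) y (suc k) (s≤s k<) = at-replicate n y k k<

at-∈ : ∀ xs k → k < length xs → at xs k ∈ xs
at-∈ (x ∷ xs) zero _ = here refl
at-∈ (x ∷ xs) (suc k) (s≤s k<) = there (at-∈ xs k k<)

countℕ-++ : ∀ x xs ys → countℕ x (xs ++ ys) ≡ countℕ x xs + countℕ x ys
countℕ-++ x [] ys = refl
countℕ-++ x (y ∷ xs) ys rewrite countℕ-++ x xs ys = sym (ℕP.+-assoc _ (countℕ x xs) (countℕ x ys))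

countℕ-absent : ∀ x ys → (∀ {y} → y ∈ ys → y ≢ x) → countℕ x ys ≡ 0
countℕ-absent x [] _ = refl
countℕ-absent x (y ∷ ys) ≢x rewrite ≢⇒≡ᵇ-false (≢x (here refl) ∘ sym) = countℕ-absent x ys (≢x ∘ there)

countℕ-replicate : ∀ x n → countℕ x (replicate n x) ≡ n
countℕ-replicate x zero = refl
countℕ-replicate x (suc n) rewrite ≡ᵇ-refl x = cong suc (countℕ-replicate x n)

memℕ-absent : ∀ x ys → (∀ {y} → y ∈ ys → y ≢ x) → memℕ x ys ≡ false
memℕ-absent x [] _ = refl
memℕ-absent x (y ∷ ys) ≢x rewrite ≢⇒≡ᵇ-false (≢x (here refl) ∘ sym) = memℕ-absent x ys (≢x ∘ there)

memℕ-++ : ∀ x xs ys → memℕ x (xs ++ ys) ≡ memℕ x xs ∨ memℕ x ys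
memℕ-++ x [] ys = refl
memℕ-++ x (y ∷ xs) ys rewrite memℕ-++ x xs ys = sym (BoolP.∨-assoc (x ≡ᵇ y) (memℕ x xs) (memℕ x ys))

length-take-≤ : ∀ {A : Set} n (xs : List A) → length (take n xs) ≤ n
length-take-≤ n xs = ℕP.≤-trans (ℕP.≤-reflexive (ListP.length-take n xs)) (ℕP.m⊓n≤m n (length xs))

blocks : ℕ → List ℕ → List ℕ
blocks j [] = []
blocks j (n ∷ cs) = replicate n j ++ blocks (suc j) cs

∈-blocks⁻ : ∀ {x} j cs → x ∈ blocks j cs → j ≤ x × x < j + length cs
∈-blocks⁻ {x} j (n ∷ cs) x∈ with ∈-++⁻ (replicate n j) x∈
... | inj₁ x∈ʳ rewrite ∈-replicate⁻ n x∈ʳ = ℕP.≤-refl , ℕP.m<m+n j (s≤s z≤n)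
... | inj₂ x∈ᵇ with ∈-blocks⁻ (suc j) cs x∈ᵇ
...   | j< , <end = ℕP.<⇒≤ j< , subst (x <_) (sym (ℕP.+-suc j (length cs))) <end

blocks-sorted : ∀ j cs → Sorted (blocks j cs)
blocks-sorted j [] = []
blocks-sorted j (n ∷ cs) = AllPairsP.++⁺ (replicate-sorted n j) (blocks-sorted (suc j) cs)
  (AllP.replicate⁺ n (All.tabulate (λ x∈ → ℕP.<⇒≤ (proj₁ (∈-blocks⁻ (suc j) cs x∈)))))

-- Row s (0-based) consists of enough entries s+1 to make it marginally large, followed by
-- cs₀ entries s+2, cs₁ entries s+3, …; cs_q is the multiplicity of the root α_{s+1} + … + α_{s+q+1}.
markedRow : ℕ → ℕ → List ℕ → List ℕ
markedRow L s cs = replicate (suc L) (suc s) ++ blocks (suc (suc s)) cs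

buildRow : List (List ℕ) → ℕ → List ℕ
buildRow [] s = []
buildRow (cs ∷ css) s = markedRow (length (buildRow css (suc s))) s cs

buildTableau : List (List ℕ) → ℕ → Tableau
buildTableau [] s = []
buildTableau (cs ∷ css) s = buildRow (cs ∷ css) s ∷ buildTableau css (suc s)

staircase : ℕ → List ℕ → List (List ℕ)
staircase zero ns = []
staircase (suc k) ns = take (suc k) ns ∷ staircase k (drop (suc k) ns)

-- posRoots lists the roots row by row (r of them starting with α_1, then r - 1 starting with α_2, …),
-- so a multiplicity list along posRoots is cut into rows of lengths r, r - 1, …, 1.
tableauOf : ℕ → List ℕ → Tableau
tableauOf r ns = buildTableau (staircase r ns) 0

data Staircase : ℕ → List (List ℕ) → Set where
  [] : Staircase 0 []
  _∷_ : ∀ {k cs css} → length cs ≤ suc k → Staircase k css → Staircase (suc k) (cs ∷ css)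

staircase-Staircase : ∀ k ns → Staircase k (staircase k ns)
staircase-Staircase zero ns = []
staircase-Staircase (suc k) ns = length-take-≤ (suc k) ns ∷ staircase-Staircase k (drop (suc k) ns)

Staircase-length : ∀ {k css} → Staircase k css → length css ≡ k
Staircase-length [] = refl
Staircase-length (_ ∷ st) = cong suc (Staircase-length st)

length-staircase : ∀ k ns → length (staircase k ns) ≡ k
length-staircase k ns = Staircase-length (staircase-Staircase k ns)

rowAt-buildTableau : ∀ css s i → rowAt (buildTableau css s) i ≡ buildRow (drop i css) (s + i)
rowAt-buildTableau [] s zero = refl
rowAt-buildTableau [] s (suc i) = refl
rowAt-buildTableau (cs ∷ css) s zero rewrite ℕP.+-identityʳ s = refl
rowAt-buildTableau (cs ∷ css) s (suc i) rewrite ℕP.+-suc s i = rowAt-buildTableau css (suc s) i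

length-buildTableau : ∀ css s → length (buildTableau css s) ≡ length css
length-buildTableau [] s = refl
length-buildTableau (cs ∷ css) s = cong suc (length-buildTableau css (suc s))

markedRow-entries : ∀ {r} L s cs → s < r → s + length cs ≤ r → ∀ {x} → x ∈ markedRow L s cs → suc s ≤ x × x ≤ suc r
markedRow-entries L s cs s<r fits x∈ with ∈-++⁻ (replicate (suc L) (suc s)) x∈
... | inj₁ x∈ʳ rewrite ∈-replicate⁻ (suc L) x∈ʳ = ℕP.≤-refl , s≤s (ℕP.<⇒≤ s<r)
... | inj₂ x∈ᵇ with ∈-blocks⁻ (suc (suc s)) cs x∈ᵇ
...   | lo , hi = ℕP.<⇒≤ lo , ℕP.≤-trans (ℕP.≤-pred hi) (s≤s fits)

markedRow-sorted : ∀ L s cs → Sorted (markedRow L s cs)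
markedRow-sorted L s cs = AllPairsP.++⁺ (replicate-sorted (suc L) (suc s)) (blocks-sorted (suc (suc s)) cs)
  (AllP.replicate⁺ (suc L) (All.tabulate (λ x∈ → ℕP.<⇒≤ (proj₁ (∈-blocks⁻ (suc (suc s)) cs x∈)))))

markedRow-count : ∀ L s cs → countℕ (suc s) (markedRow L s cs) ≡ suc L
markedRow-count L s cs
  rewrite countℕ-++ (suc s) (replicate (suc L) (suc s)) (blocks (suc (suc s)) cs)
        | countℕ-replicate (suc s) (suc L)
        | countℕ-absent (suc s) (blocks (suc (suc s)) cs) (λ y∈ e → ℕP.<-irrefl (sym e) (proj₁ (∈-blocks⁻ (suc (suc s)) cs y∈)))
        = ℕP.+-identityʳ (suc L)

markedRow-length : ∀ L s cs → L ≤ length (markedRow L s cs)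
markedRow-length L s cs
  rewrite ListP.length-++ (replicate (suc L) (suc s)) {blocks (suc (suc s)) cs} | ListP.length-replicate L {suc s}
  = ℕP.≤-trans (ℕP.n≤1+n L) (ℕP.m≤m+n (suc L) _)

markedRow-at : ∀ L s cs k → k < suc L → at (markedRow L s cs) k ≡ suc s
markedRow-at L s cs k k< =
  trans (at-++ˡ (replicate (suc L) (suc s)) _ k (subst (k <_) (sym (ListP.length-replicate (suc L))) k<))
        (at-replicate (suc L) (suc s) k k<)

Staircase-drop : ∀ {k css} → Staircase k css → ∀ i → i < k →
  ∃ λ cs → ∃ λ css′ → drop i css ≡ cs ∷ css′ × i + length cs ≤ k
Staircase-drop {css = cs ∷ css} (cs≤ ∷ st) zero _ = cs , css , refl , cs≤
Staircase-drop (_ ∷ st) (suc i) (s≤s i<) with Staircase-drop st i i<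
... | cs , css′ , e , fits = cs , css′ , e , s≤s fits

drop-suc : ∀ {A : Set} i (xs : List A) {y ys} → drop i xs ≡ y ∷ ys → drop (suc i) xs ≡ ys
drop-suc zero (x ∷ xs) refl = refl
drop-suc (suc i) (x ∷ xs) e = drop-suc i xs e

∈-rowAt⁻ : ∀ {row : List ℕ} (b : Tableau) → row ∈ b → ∃ λ i → i < length b × rowAt b i ≡ row
∈-rowAt⁻ (x ∷ b) (here refl) = 0 , s≤s z≤n , refl
∈-rowAt⁻ (x ∷ b) (there row∈) with ∈-rowAt⁻ b row∈
... | i , i< , e = suc i , s≤s i< , e

rowAt-∈ : ∀ (b : Tableau) i → i < length b → rowAt b i ∈ b
rowAt-∈ (x ∷ b) zero _ = here refl
rowAt-∈ (x ∷ b) (suc i) (s≤s i<) = there (rowAt-∈ b i i<)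

module _ (r : ℕ) {css : List (List ℕ)} (st : Staircase r css) where

  private
    b : Tableau
    b = buildTableau css 0

    record RowView (i : ℕ) : Set where
      field
        cs : List ℕ
        below : List ℕ
        row≡ : rowAt b i ≡ markedRow (length below) i cs
        next≡ : rowAt b (suc i) ≡ below
        fits : i + length cs ≤ r

    view : ∀ i → i < r → RowView i
    view i i<r with Staircase-drop st i i<r
    ... | cs , css′ , e , fits = record
      { cs = cs
      ; below = buildRow css′ (suc i)
      ; row≡ = trans (rowAt-buildTableau css 0 i) (cong (λ z → buildRow z i) e)
      ; next≡ = trans (rowAt-buildTableau css 0 (suc i)) (cong (λ z → buildRow z (suc i)) (drop-suc i css e))
      ; fits = fits
      }

    length-b : length b ≡ r
    length-b = trans (length-buildTableau css 0) (Staircase-length st)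

    row-entries : ∀ i → i < r → ∀ {x} → x ∈ rowAt b i → suc i ≤ x × x ≤ suc r
    row-entries i i<r x∈ = markedRow-entries _ i cs i<r fits (subst (_ ∈_) row≡ x∈)
      where open RowView (view i i<r)

    entries : ∀ {row} → row ∈ b → ∀ {x} → x ∈ row → 1 ≤ x × x ≤ suc r
    entries row∈ x∈ with ∈-rowAt⁻ b row∈
    ... | i , i< , refl = let (lo , hi) = row-entries i (subst (i <_) length-b i<) x∈ in
                          ℕP.≤-trans (s≤s z≤n) lo , hi

    cols : ∀ i → suc i < r → ∀ k → k < length (rowAt b (suc i)) → at (rowAt b i) k < at (rowAt b (suc i)) k
    cols i i+1<r k k< = subst (_< at (rowAt b (suc i)) k) (sym at≡) below-entry
      where
      open RowView (view i (ℕP.<⇒≤ i+1<r))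
      at≡ : at (rowAt b i) k ≡ suc i
      at≡ = trans (cong (λ z → at z k) row≡) (markedRow-at _ i cs k (ℕP.m<n⇒m<1+n (subst (k <_) (cong length next≡) k<)))
      below-entry : suc i < at (rowAt b (suc i)) k
      below-entry = proj₁ (row-entries (suc i) i+1<r (at-∈ (rowAt b (suc i)) k k<))

  buildTableau-InTinf : InTinf r (buildTableau css 0)
  buildTableau-InTinf = record
    { nrows = length-b
    ; entries = entries
    ; shape = λ i i+1<r → let open RowView (view i (ℕP.<⇒≤ i+1<r)) in
        subst₂ (λ z w → length z ≤ length w) (sym next≡) (sym row≡) (markedRow-length _ i cs)
    ; rowsWeak = λ i i<r k k< → let open RowView (view i i<r) in
        subst (λ z → suc k < length z → at z k ≤ at z (suc k)) (sym row≡) (sorted-at (markedRow-sorted _ i cs) k) k<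
    ; colsStrict = cols
    ; leftCol = λ i i<r → let open RowView (view i i<r) in
        subst (λ z → 0 < length z × at z 0 ≡ suc i) (sym row≡) (s≤s z≤n , markedRow-at (length below) i cs 0 (s≤s z≤n))
    ; marginal = λ i i<r → let open RowView (view i i<r) in
        subst₂ (λ z w → countℕ (suc i) z ≡ suc (length w)) (sym row≡) (sym next≡) (markedRow-count _ i cs)
    }

Σrows : (ℕ → List ℕ → ℕ) → ℕ → List (List ℕ) → ℕ
Σrows H s [] = 0
Σrows H s (cs ∷ css) = H s (buildRow (cs ∷ css) s) + Σrows H (suc s) css

Σn-rowAt-buildTableau : ∀ (H : ℕ → List ℕ → ℕ) css s →
  Σn (range 0 (length css)) (λ i → H (s + i) (rowAt (buildTableau css s) i)) ≡ Σrows H s css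
Σn-rowAt-buildTableau H [] s = refl
Σn-rowAt-buildTableau H (cs ∷ css) s = cong₂ _+_
  (cong (λ z → H z (buildRow (cs ∷ css) s)) (ℕP.+-identityʳ s))
  (trans (Σn-range-shift 0 (length css) (λ i → H (s + i) (rowAt (buildTableau (cs ∷ css) s) i)))
  (trans (Σn-cong (range 0 (length css)) (λ i → cong (λ z → H z (rowAt (buildTableau css (suc s)) i)) (ℕP.+-suc s i)))
         (Σn-rowAt-buildTableau H css (suc s))))

Σn-rows-tableauOf : ∀ (H : ℕ → List ℕ → ℕ) r ns →
  Σn (upTo r) (λ i → H i (rowAt (tableauOf r ns) i)) ≡ Σrows H 0 (staircase r ns)
Σn-rows-tableauOf H r ns = begin
    Σn (upTo r) (λ i → H i (rowAt (tableauOf r ns) i))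
  ≡⟨ cong (λ l → Σn l (λ i → H i (rowAt (tableauOf r ns) i)))
          (trans (upTo≡range r) (cong (range 0) (sym (length-staircase r ns)))) ⟩
    Σn (range 0 (length (staircase r ns))) (λ i → H i (rowAt (tableauOf r ns) i))
  ≡⟨ Σn-rowAt-buildTableau H (staircase r ns) 0 ⟩
    Σrows H 0 (staircase r ns) ∎

≤ᵇ-true : ∀ {m n} → m ≤ n → (m ≤ᵇ n) ≡ true
≤ᵇ-true {m} {n} = dec-true (m ℕ.≤? n)

≤ᵇ-false : ∀ {m n} → ¬ m ≤ n → (m ≤ᵇ n) ≡ false
≤ᵇ-false {m} {n} = dec-false (m ℕ.≤? n)

rowNegWt : ℕ → ℕ → List ℕ → ℕ
rowNegWt p i row = if i ≤ᵇ p then length (filter (λ j → suc (suc p) ℕ.≤? j) row) else 0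

blockNegWt : ℕ → ℕ → List ℕ → ℕ
blockNegWt p j [] = 0
blockNegWt p j (n ∷ cs) = (if p ≤ᵇ j then n else 0) + blockNegWt p (suc j) cs

length-filter-blocks : ∀ p j cs → length (filter (λ x → suc (suc p) ℕ.≤? x) (blocks (suc (suc j)) cs)) ≡ blockNegWt p j cs
length-filter-blocks p j [] = refl
length-filter-blocks p j (n ∷ cs)
  rewrite ListP.filter-++ (λ x → suc (suc p) ℕ.≤? x) (replicate n (suc (suc j))) (blocks (suc (suc (suc j))) cs)
        | ListP.length-++ (filter (λ x → suc (suc p) ℕ.≤? x) (replicate n (suc (suc j))))
                          {filter (λ x → suc (suc p) ℕ.≤? x) (blocks (suc (suc (suc j))) cs)}
        | length-filter-blocks p (suc j) cs
        = cong (_+ blockNegWt p (suc j) cs) first-block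
  where
  first-block : length (filter (λ x → suc (suc p) ℕ.≤? x) (replicate n (suc (suc j)))) ≡ (if p ≤ᵇ j then n else 0)
  first-block with p ℕ.≤? j
  ... | yes p≤j rewrite ≤ᵇ-true p≤j
        | ListP.filter-all (λ x → suc (suc p) ℕ.≤? x) (AllP.replicate⁺ {P = λ x → suc (suc p) ≤ x} n (s≤s (s≤s p≤j)))
        = ListP.length-replicate n
  ... | no p≰j rewrite ≤ᵇ-false p≰j
        | ListP.filter-none (λ x → suc (suc p) ℕ.≤? x) (AllP.replicate⁺ {P = λ x → ¬ suc (suc p) ≤ x} n (p≰j ∘ ℕP.≤-pred ∘ ℕP.≤-pred))
        = refl

rowNegWt-markedRow : ∀ p L s cs → rowNegWt p s (markedRow L s cs) ≡ (if s ≤ᵇ p then blockNegWt p s cs else 0)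
rowNegWt-markedRow p L s cs with s ℕ.≤? p
... | no s≰p rewrite ≤ᵇ-false s≰p = refl
... | yes s≤p rewrite ≤ᵇ-true s≤p
        | ListP.filter-++ (λ x → suc (suc p) ℕ.≤? x) (replicate (suc L) (suc s)) (blocks (suc (suc s)) cs)
        | ListP.filter-none (λ x → suc (suc p) ℕ.≤? x)
            (AllP.replicate⁺ {P = λ x → ¬ suc (suc p) ≤ x} (suc L) (λ h → ℕP.<-irrefl refl (ℕP.≤-trans h (s≤s s≤p))))
        = length-filter-blocks p s cs

Σchunks : (ℕ → List ℕ → ℕ) → ℕ → ℕ → List ℕ → ℕ
Σchunks f s zero ns = 0
Σchunks f s (suc k) ns = f s (take (suc k) ns) + Σchunks f (suc s) k (drop (suc k) ns)

module _ {r : ℕ} where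

  lookup-vadd : ∀ (u v : Vec ℕ r) p → lookup (vadd u v) p ≡ lookup u p + lookup v p
  lookup-vadd u v p = VecP.lookup-zipWith _+_ p u v

  lookup-scal : ∀ n (u : Vec ℕ r) p → lookup (scal n u) p ≡ n * lookup u p
  lookup-scal n u p = VecP.lookup-map p (n *_) u

  lookup-zeroV : ∀ p → lookup (zeroV {r}) p ≡ 0
  lookup-zeroV p = VecP.lookup-replicate p 0

  lookup-linComb-++ : ∀ ns (xs ys : List (Vec ℕ r)) p →
    lookup (linComb ns (xs ++ ys)) p ≡ lookup (linComb (take (length xs) ns) xs) p + lookup (linComb (drop (length xs) ns) ys) p
  lookup-linComb-++ ns [] ys p rewrite lookup-zeroV p = refl
  lookup-linComb-++ [] (α ∷ xs) ys p rewrite lookup-zeroV p = refl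
  lookup-linComb-++ (n ∷ ns) (α ∷ xs) ys p
    rewrite lookup-vadd (scal n α) (linComb ns (xs ++ ys)) p
          | lookup-vadd (scal n α) (linComb (take (length xs) ns) xs) p
          | lookup-linComb-++ ns xs ys p
          = sym (ℕP.+-assoc (lookup (scal n α) p) _ _)

  -- The roots α_{s+1} + … + α_{s+q+1}, attached to the entries s+q+2 of row s.
  rowRoots : ℕ → List (Vec ℕ r)
  rowRoots s = map (λ q → rootVec r s (s + q)) (upTo (r ∸ s))

  length-rowRoots : ∀ s k → s + suc k ≡ r → length (rowRoots s) ≡ suc k
  length-rowRoots s k e = trans (ListP.length-map _ (upTo (r ∸ s))) (trans (ListP.length-applyUpTo _ (r ∸ s))
                                (trans (cong (_∸ s) (sym e)) (ℕP.m+n∸m≡n s (suc k))))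

  lookup-rootVec : ∀ i j (p : Fin r) → lookup (rootVec r i j) p ≡ (if (i ≤ᵇ toℕ p) ∧ (toℕ p ≤ᵇ j) then 1 else 0)
  lookup-rootVec i j p = VecP.lookup∘tabulate _ p

  lookup-linComb-roots : ∀ s t l cs (p : Fin r) → length cs ≤ l →
    lookup (linComb cs (map (λ q → rootVec r s (s + q)) (range t l))) p
    ≡ (if s ≤ᵇ toℕ p then blockNegWt (toℕ p) (s + t) cs else 0)
  lookup-linComb-roots s t l [] p _ rewrite lookup-zeroV p with s ≤ᵇ toℕ p
  ... | true = refl
  ... | false = refl
  lookup-linComb-roots s t (suc l) (n ∷ cs) p (s≤s cs≤l)
    rewrite lookup-vadd (scal n (rootVec r s (s + t))) (linComb cs (map (λ q → rootVec r s (s + q)) (range (suc t) l))) p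
          | lookup-scal n (rootVec r s (s + t)) p
          | lookup-rootVec s (s + t) p
          | lookup-linComb-roots s (suc t) l cs p cs≤l
          | ℕP.+-suc s t
          with s ≤ᵇ toℕ p
  ... | false = cong (_+ 0) (ℕP.*-zeroʳ n)
  ... | true with toℕ p ≤ᵇ s + t
  ...   | true = cong (_+ blockNegWt (toℕ p) (suc (s + t)) cs) (ℕP.*-identityʳ n)
  ...   | false = cong (_+ blockNegWt (toℕ p) (suc (s + t)) cs) (ℕP.*-zeroʳ n)

  lookup-linComb-rowRoots : ∀ s cs (p : Fin r) → length cs ≤ r ∸ s →
    lookup (linComb cs (rowRoots s)) p ≡ (if s ≤ᵇ toℕ p then blockNegWt (toℕ p) s cs else 0)
  lookup-linComb-rowRoots s cs p cs≤ = begin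
      lookup (linComb cs (rowRoots s)) p
    ≡⟨ cong (λ l → lookup (linComb cs (map (λ q → rootVec r s (s + q)) l)) p) (upTo≡range (r ∸ s)) ⟩
      lookup (linComb cs (map (λ q → rootVec r s (s + q)) (range 0 (r ∸ s)))) p
    ≡⟨ lookup-linComb-roots s 0 (r ∸ s) cs p cs≤ ⟩
      (if s ≤ᵇ toℕ p then blockNegWt (toℕ p) (s + 0) cs else 0)
    ≡⟨ cong (λ z → if s ≤ᵇ toℕ p then blockNegWt (toℕ p) z cs else 0) (ℕP.+-identityʳ s) ⟩
      (if s ≤ᵇ toℕ p then blockNegWt (toℕ p) s cs else 0) ∎

  lookup-linComb-chunks : ∀ p s k ns → s + k ≡ r →
    lookup (linComb ns (concatMap rowRoots (range s k))) p ≡ Σchunks (λ s cs → lookup (linComb cs (rowRoots s)) p) s k ns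
  lookup-linComb-chunks p s zero [] _ = lookup-zeroV p
  lookup-linComb-chunks p s zero (n ∷ ns) _ = lookup-zeroV p
  lookup-linComb-chunks p s (suc k) ns e
    rewrite lookup-linComb-++ ns (rowRoots s) (concatMap rowRoots (range (suc s) k)) p | length-rowRoots s k e =
    cong (lookup (linComb (take (suc k) ns) (rowRoots s)) p +_)
         (lookup-linComb-chunks p (suc s) k (drop (suc k) ns) (trans (sym (ℕP.+-suc s k)) e))

  Σrows-rowNegWt : ∀ (p : Fin r) s k ns → s + k ≡ r →
    Σrows (rowNegWt (toℕ p)) s (staircase k ns) ≡ Σchunks (λ s cs → lookup (linComb cs (rowRoots s)) p) s k ns
  Σrows-rowNegWt p s zero ns e = refl
  Σrows-rowNegWt p s (suc k) ns e = cong₂ _+_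
    (trans (rowNegWt-markedRow (toℕ p) _ s (take (suc k) ns))
           (sym (lookup-linComb-rowRoots s (take (suc k) ns) p
                  (subst (length (take (suc k) ns) ≤_) (sym (trans (cong (_∸ s) (sym e)) (ℕP.m+n∸m≡n s (suc k))))
                         (length-take-≤ (suc k) ns)))))
    (Σrows-rowNegWt p (suc s) k (drop (suc k) ns) (trans (sym (ℕP.+-suc s k)) e))

negWt-tableauOf : ∀ r ns → negWt r (tableauOf r ns) ≡ linComb ns (posRoots r)
negWt-tableauOf r ns = trans (VecP.tabulate-cong coordinate) (VecP.tabulate∘lookup (linComb ns (posRoots r)))
  where
  coordinate : ∀ p →
    Σn (upTo r) (λ i → rowNegWt (toℕ p) i (rowAt (tableauOf r ns) i)) ≡ lookup (linComb ns (posRoots r)) p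
  coordinate p = begin
      Σn (upTo r) (λ i → rowNegWt (toℕ p) i (rowAt (tableauOf r ns) i))
    ≡⟨ Σn-rows-tableauOf (rowNegWt (toℕ p)) r ns ⟩
      Σrows (rowNegWt (toℕ p)) 0 (staircase r ns)
    ≡⟨ Σrows-rowNegWt p 0 r ns refl ⟩
      Σchunks (λ s cs → lookup (linComb cs (rowRoots s)) p) 0 r ns
    ≡⟨ sym (lookup-linComb-chunks p 0 r ns refl) ⟩
      lookup (linComb ns (concatMap rowRoots (range 0 r))) p
    ≡⟨ cong (λ l → lookup (linComb ns (concatMap rowRoots l)) p) (sym (upTo≡range r)) ⟩
      lookup (linComb ns (posRoots r)) p ∎

indicator : Bool → ℕ
indicator b = if b then 1 else 0

Σn-triangle-swap : ∀ r (f : ℕ → ℕ → ℕ) →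
  Σn (range 0 r) (λ q → Σn (range 0 (suc q)) (λ i → f i q)) ≡ Σn (range 0 r) (λ i → Σn (range i (r ∸ i)) (f i))
Σn-triangle-swap zero f = refl
Σn-triangle-swap (suc r) f = begin
    Σn (range 0 (suc r)) (λ q → Σn (range 0 (suc q)) (λ i → f i q))
  ≡⟨ cong (λ l → Σn l (λ q → Σn (range 0 (suc q)) (λ i → f i q))) (range-snoc 0 r) ⟩
    Σn (range 0 r ++ [ r ]) (λ q → Σn (range 0 (suc q)) (λ i → f i q))
  ≡⟨ Σn-++ (range 0 r) [ r ] (λ q → Σn (range 0 (suc q)) (λ i → f i q)) ⟩
    Σn (range 0 r) (λ q → Σn (range 0 (suc q)) (λ i → f i q)) + (Σn (range 0 (suc r)) (λ i → f i r) + 0)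
  ≡⟨ cong₂ _+_ (Σn-triangle-swap r f) (ℕP.+-identityʳ _) ⟩
    Σn (range 0 r) F + Σn (range 0 (suc r)) (λ i → f i r)
  ≡⟨ cong (_+ Σn (range 0 (suc r)) (λ i → f i r)) (sym F-last) ⟩
    Σn (range 0 (suc r)) F + Σn (range 0 (suc r)) (λ i → f i r)
  ≡⟨ sym (Σn-+ (range 0 (suc r)) F (λ i → f i r)) ⟩
    Σn (range 0 (suc r)) (λ i → F i + f i r)
  ≡⟨ Σn-cong∈ (range 0 (suc r)) extend ⟩
    Σn (range 0 (suc r)) (λ i → Σn (range i (suc r ∸ i)) (f i)) ∎
  where
  F : ℕ → ℕ
  F i = Σn (range i (r ∸ i)) (f i)
  F-last : Σn (range 0 (suc r)) F ≡ Σn (range 0 r) F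
  F-last = trans (cong (λ l → Σn l F) (range-snoc 0 r))
           (trans (Σn-++ (range 0 r) [ r ] F)
           (trans (cong (λ z → Σn (range 0 r) F + (Σn (range r z) (f r) + 0)) (ℕP.n∸n≡0 r))
                  (ℕP.+-identityʳ _)))
  extend : ∀ i → i ∈ range 0 (suc r) → F i + f i r ≡ Σn (range i (suc r ∸ i)) (f i)
  extend i i∈ with ∈-range⁻ 0 (suc r) i∈
  ... | _ , s≤s i≤r = sym (begin
      Σn (range i (suc r ∸ i)) (f i)
    ≡⟨ cong (λ z → Σn (range i z) (f i)) (ℕP.+-∸-assoc 1 i≤r) ⟩
      Σn (range i (suc (r ∸ i))) (f i)
    ≡⟨ cong (λ l → Σn l (f i)) (range-snoc i (r ∸ i)) ⟩
      Σn (range i (r ∸ i) ++ [ i + (r ∸ i) ]) (f i)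
    ≡⟨ Σn-++ (range i (r ∸ i)) [ i + (r ∸ i) ] (f i) ⟩
      F i + (f i (i + (r ∸ i)) + 0)
    ≡⟨ cong (λ z → F i + (f i z + 0)) (ℕP.m+[n∸m]≡n i≤r) ⟩
      F i + (f i r + 0)
    ≡⟨ cong (F i +_) (ℕP.+-identityʳ (f i r)) ⟩
      F i + f i r ∎)

Σn-indicator-blocks : ∀ j l cs → length cs ≤ l →
  Σn (range j l) (λ q → indicator (memℕ (suc (suc q)) (blocks (suc (suc j)) cs))) ≡ nonzeros cs
Σn-indicator-blocks j l [] _ = Σn-zero (range j l)
Σn-indicator-blocks j (suc l) (n ∷ cs) (s≤s cs≤l) =
  trans (cong₂ _+_ first (trans (Σn-cong∈ (range (suc j) l) later) (Σn-indicator-blocks (suc j) l cs cs≤l))) (head n)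
  where
  X = suc (suc j)
  first : indicator (memℕ X (replicate n X ++ blocks (suc X) cs)) ≡ indicator (memℕ X (replicate n X))
  first rewrite memℕ-++ X (replicate n X) (blocks (suc X) cs)
              | memℕ-absent X (blocks (suc X) cs) (λ y∈ e → ℕP.<-irrefl (sym e) (proj₁ (∈-blocks⁻ (suc X) cs y∈)))
              = cong indicator (BoolP.∨-identityʳ _)
  later : ∀ q → q ∈ range (suc j) l →
    indicator (memℕ (suc (suc q)) (replicate n X ++ blocks (suc X) cs)) ≡ indicator (memℕ (suc (suc q)) (blocks (suc X) cs))
  later q q∈ rewrite memℕ-++ (suc (suc q)) (replicate n X) (blocks (suc X) cs)
                   | memℕ-absent (suc (suc q)) (replicate n X)
                       (λ y∈ e → ℕP.<-irrefl (cong (ℕ.pred ∘ ℕ.pred) (trans (sym (∈-replicate⁻ n y∈)) e))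
                                             (proj₁ (∈-range⁻ (suc j) l q∈)))
                   = refl
  head : ∀ n → indicator (memℕ X (replicate n X)) + nonzeros cs ≡ nonzeros (n ∷ cs)
  head zero = refl
  head (suc n) rewrite ≡ᵇ-refl X = refl

triangle : ℕ → ℕ
triangle zero = 0
triangle (suc k) = suc k + triangle k

module _ (r : ℕ) where

  rowSegments : ℕ → List ℕ → ℕ
  rowSegments i row = Σn (range i (r ∸ i)) (λ q → indicator (memℕ (suc (suc q)) row))

  rowSegments-markedRow : ∀ L s cs → length cs ≤ r ∸ s → rowSegments s (markedRow L s cs) ≡ nonzeros cs
  rowSegments-markedRow L s cs cs≤ = trans (Σn-cong∈ (range s (r ∸ s)) skip-marked) (Σn-indicator-blocks s (r ∸ s) cs cs≤)
    where
    skip-marked : ∀ q → q ∈ range s (r ∸ s) →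
      indicator (memℕ (suc (suc q)) (markedRow L s cs)) ≡ indicator (memℕ (suc (suc q)) (blocks (suc (suc s)) cs))
    skip-marked q q∈ rewrite memℕ-++ (suc (suc q)) (replicate (suc L) (suc s)) (blocks (suc (suc s)) cs)
                           | memℕ-absent (suc (suc q)) (replicate (suc L) (suc s))
                               (λ y∈ e → ℕP.<-irrefl (trans (sym (∈-replicate⁻ (suc L) y∈)) e)
                                                     (s≤s (s≤s (proj₁ (∈-range⁻ s (r ∸ s) q∈)))))
                           = refl

  Σrows-rowSegments : ∀ k s ns → s + k ≡ r → length ns ≤ triangle k → Σrows rowSegments s (staircase k ns) ≡ nonzeros ns
  Σrows-rowSegments zero s [] e _ = refl
  Σrows-rowSegments (suc k) s ns e ns≤ = trans (cong₂ _+_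
      (rowSegments-markedRow (length (buildRow (staircase k (drop (suc k) ns)) (suc s))) s (take (suc k) ns)
         (subst (length (take (suc k) ns) ≤_) (sym r∸s) (length-take-≤ (suc k) ns)))
      (Σrows-rowSegments k (suc s) (drop (suc k) ns) (trans (sym (ℕP.+-suc s k)) e)
        (subst (_≤ triangle k) (sym (ListP.length-drop (suc k) ns))
               (ℕP.≤-trans (ℕP.∸-monoˡ-≤ (suc k) ns≤) (ℕP.≤-reflexive (ℕP.m+n∸m≡n (suc k) (triangle k)))))))
    (nonzeros-take-drop (suc k) ns)
    where
    r∸s : r ∸ s ≡ suc k
    r∸s = trans (cong (_∸ s) (sym e)) (ℕP.m+n∸m≡n s (suc k))

  seg-tableauOf : ∀ ns → length ns ≤ triangle r → seg r (tableauOf r ns) ≡ nonzeros ns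
  seg-tableauOf ns ns≤ = begin
      Σn (upTo r) (λ q → Σn (upTo (q + 2 ∸ 1)) (λ i → indicator (memℕ (q + 2) (rowAt b i))))
    ≡⟨ cong (λ l → Σn l (λ q → Σn (upTo (q + 2 ∸ 1)) (λ i → indicator (memℕ (q + 2) (rowAt b i)))))
            (upTo≡range r) ⟩
      Σn (range 0 r) (λ q → Σn (upTo (q + 2 ∸ 1)) (λ i → indicator (memℕ (q + 2) (rowAt b i))))
    ≡⟨ Σn-cong (range 0 r) rows-above ⟩
      Σn (range 0 r) (λ q → Σn (range 0 (suc q)) (λ i → indicator (memℕ (suc (suc q)) (rowAt b i))))
    ≡⟨ Σn-triangle-swap r (λ i q → indicator (memℕ (suc (suc q)) (rowAt b i))) ⟩
      Σn (range 0 r) (λ i → rowSegments i (rowAt b i))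
    ≡⟨ trans (cong (λ l → Σn l (λ i → rowSegments i (rowAt b i))) (sym (upTo≡range r)))
             (Σn-rows-tableauOf rowSegments r ns) ⟩
      Σrows rowSegments 0 (staircase r ns)
    ≡⟨ Σrows-rowSegments r 0 ns refl ns≤ ⟩
      nonzeros ns ∎
    where
    b = tableauOf r ns
    rows-above : ∀ q → Σn (upTo (q + 2 ∸ 1)) (λ i → indicator (memℕ (q + 2) (rowAt b i)))
                     ≡ Σn (range 0 (suc q)) (λ i → indicator (memℕ (suc (suc q)) (rowAt b i)))
    rows-above q rewrite ℕP.+-comm q 2 =
      cong (λ l → Σn l (λ i → indicator (memℕ (suc (suc q)) (rowAt b i)))) (upTo≡range (suc q))

counts : ℕ → ℕ → List ℕ → List ℕ
counts j zero row = []
counts j (suc l) row = countℕ j row ∷ counts (suc j) l row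

rowCounts : ℕ → ℕ → Tableau → List (List ℕ)
rowCounts s zero b = []
rowCounts s (suc k) b = counts (suc (suc s)) (suc k) (rowAt b 0) ∷ rowCounts (suc s) k (drop 1 b)

multiplicities : ℕ → Tableau → List ℕ
multiplicities r b = concat (rowCounts 0 r b)

length-counts : ∀ j l row → length (counts j l row) ≡ l
length-counts j zero row = refl
length-counts j (suc l) row = cong suc (length-counts (suc j) l row)

take-++-exact : ∀ {A : Set} n (xs ys : List A) → length xs ≡ n → take n (xs ++ ys) ≡ xs
take-++-exact zero [] ys e = refl
take-++-exact (suc n) (x ∷ xs) ys e = cong (x ∷_) (take-++-exact n xs ys (ℕP.suc-injective e))

drop-++-exact : ∀ {A : Set} n (xs ys : List A) → length xs ≡ n → drop n (xs ++ ys) ≡ ys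
drop-++-exact zero [] ys e = refl
drop-++-exact (suc n) (x ∷ xs) ys e = drop-++-exact n xs ys (ℕP.suc-injective e)

staircase-rowCounts : ∀ k s b → staircase k (concat (rowCounts s k b)) ≡ rowCounts s k b
staircase-rowCounts zero s b = refl
staircase-rowCounts (suc k) s b = cong₂ _∷_
  (take-++-exact (suc k) row rest (length-counts _ (suc k) _))
  (trans (cong (staircase k) (drop-++-exact (suc k) row rest (length-counts _ (suc k) _)))
         (staircase-rowCounts k (suc s) (drop 1 b)))
  where
  row = counts (suc (suc s)) (suc k) (rowAt b 0)
  rest = concat (rowCounts (suc s) k (drop 1 b))

length-rowCounts : ∀ k s b → length (concat (rowCounts s k b)) ≡ triangle k
length-rowCounts zero s b = refl
length-rowCounts (suc k) s b = trans (ListP.length-++ (counts (suc (suc s)) (suc k) (rowAt b 0)))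
  (cong₂ _+_ (length-counts _ (suc k) _) (length-rowCounts k (suc s) (drop 1 b)))

counts-++-below : ∀ j l xs ys → All (_< j) xs → counts j l (xs ++ ys) ≡ counts j l ys
counts-++-below j zero xs ys _ = refl
counts-++-below j (suc l) xs ys xs<j = cong₂ _∷_
  (trans (countℕ-++ j xs ys) (cong (_+ countℕ j ys) (countℕ-absent j xs (λ y∈ e → ℕP.<-irrefl e (All.lookup xs<j y∈)))))
  (counts-++-below (suc j) l xs ys (All.map ℕP.m<n⇒m<1+n xs<j))

counts-blocks : ∀ j cs → counts j (length cs) (blocks j cs) ≡ cs
counts-blocks j [] = refl
counts-blocks j (n ∷ cs) = cong₂ _∷_ count-first
  (trans (counts-++-below (suc j) (length cs) (replicate n j) (blocks (suc j) cs) (AllP.replicate⁺ n (ℕP.n<1+n j)))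
         (counts-blocks (suc j) cs))
  where
  count-first : countℕ j (replicate n j ++ blocks (suc j) cs) ≡ n
  count-first rewrite countℕ-++ j (replicate n j) (blocks (suc j) cs) | countℕ-replicate j n
                    | countℕ-absent j (blocks (suc j) cs) (λ y∈ e → ℕP.<-irrefl (sym e) (proj₁ (∈-blocks⁻ (suc j) cs y∈)))
                    = ℕP.+-identityʳ n

counts-markedRow : ∀ L s cs → counts (suc (suc s)) (length cs) (markedRow L s cs) ≡ cs
counts-markedRow L s cs =
  trans (counts-++-below (suc (suc s)) (length cs) (replicate (suc L) (suc s)) (blocks (suc (suc s)) cs)
                         (AllP.replicate⁺ (suc L) (ℕP.n<1+n (suc s))))
        (counts-blocks (suc (suc s)) cs)

rowCounts-buildTableau : ∀ k s ns → length ns ≡ triangle k → concat (rowCounts s k (buildTableau (staircase k ns) s)) ≡ ns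
rowCounts-buildTableau zero s [] e = refl
rowCounts-buildTableau (suc k) s ns e =
  trans (cong₂ _++_ first-row (rowCounts-buildTableau k (suc s) (drop (suc k) ns) length-rest)) (ListP.take++drop≡id (suc k) ns)
  where
  length-first : length (take (suc k) ns) ≡ suc k
  length-first = trans (ListP.length-take (suc k) ns) (ℕP.m≤n⇒m⊓n≡m (subst (suc k ≤_) (sym e) (ℕP.m≤m+n (suc k) (triangle k))))
  length-rest : length (drop (suc k) ns) ≡ triangle k
  length-rest = trans (ListP.length-drop (suc k) ns) (trans (cong (_∸ suc k) e) (ℕP.m+n∸m≡n (suc k) (triangle k)))
  first-row : counts (suc (suc s)) (suc k) (buildRow (staircase (suc k) ns) s) ≡ take (suc k) ns
  first-row = subst (λ z → counts (suc (suc s)) z (buildRow (staircase (suc k) ns) s) ≡ take (suc k) ns) length-first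
                    (counts-markedRow _ s (take (suc k) ns))

multiplicities-tableauOf : ∀ r ns → length ns ≡ triangle r → multiplicities r (tableauOf r ns) ≡ ns
multiplicities-tableauOf r = rowCounts-buildTableau r 0

counts-[] : ∀ j m → blocks j (counts j m []) ≡ []
counts-[] j zero = refl
counts-[] j (suc m) = counts-[] (suc j) m

sorted≡blocks-counts : ∀ l a xs → Sorted xs → All (λ z → a ≤ z × z ≤ a + l) xs → xs ≡ blocks a (counts a (suc l) xs)
sorted≡blocks-counts l a [] _ _ = sym (counts-[] (suc a) l)
sorted≡blocks-counts l a (x ∷ xs) (x≤xs ∷ sorted) (x∈ ∷ xs∈) with x ℕ.≟ a
... | yes refl rewrite ≡ᵇ-refl x | counts-++-below (suc x) l [ x ] xs (ℕP.n<1+n x ∷ []) =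
  cong (x ∷_) (sorted≡blocks-counts l x xs sorted xs∈)
sorted≡blocks-counts zero a (x ∷ xs) _ (x∈ ∷ _) | no x≢a =
  ⊥-elim (x≢a (ℕP.≤-antisym (subst (x ≤_) (ℕP.+-identityʳ a) (proj₂ x∈)) (proj₁ x∈)))
sorted≡blocks-counts (suc l) a (x ∷ xs) (x≤xs ∷ sorted) (x∈ ∷ xs∈) | no x≢a =
  trans (sorted≡blocks-counts l (suc a) (x ∷ xs) (x≤xs ∷ sorted) (All.tabulate bounds))
        (cong (λ n → replicate n a ++ blocks (suc a) (counts (suc a) (suc l) (x ∷ xs))) (sym (countℕ-absent a (x ∷ xs) ≢a)))
  where
  a<x : a < x
  a<x = ℕP.≤∧≢⇒< (proj₁ x∈) (x≢a ∘ sym)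
  x≤ : ∀ {z} → z ∈ x ∷ xs → x ≤ z
  x≤ (here refl) = ℕP.≤-refl
  x≤ (there z∈) = All.lookup x≤xs z∈
  ≤a+l : ∀ {z} → z ∈ x ∷ xs → z ≤ a + suc l
  ≤a+l (here refl) = proj₂ x∈
  ≤a+l (there z∈) = proj₂ (All.lookup xs∈ z∈)
  ≢a : ∀ {y} → y ∈ x ∷ xs → y ≢ a
  ≢a y∈ e = ℕP.<-irrefl (sym e) (ℕP.<-≤-trans a<x (x≤ y∈))
  bounds : ∀ {z} → z ∈ x ∷ xs → suc a ≤ z × z ≤ suc a + l
  bounds {z} z∈ = ℕP.<-≤-trans a<x (x≤ z∈) , subst (z ≤_) (ℕP.+-suc a l) (≤a+l z∈)

-- x is row t (0-based) of a marginally large tableau with entries ≤ R + 1, and y is the row below.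
MarginalRow : ℕ → ℕ → List ℕ → List ℕ → Set
MarginalRow t R x y = Sorted x × All (λ z → suc t ≤ z × z ≤ suc R) x × countℕ (suc t) x ≡ suc (length y)

MarginalRows : ℕ → ℕ → Tableau → Set
MarginalRows s k b = length b ≡ k × (∀ i → i < k → MarginalRow (s + i) (s + k) (rowAt b i) (rowAt b (suc i)))

MarginalRows-tail : ∀ s k x b → MarginalRows s (suc k) (x ∷ b) → MarginalRows (suc s) k b
MarginalRows-tail s k x b (len , rows) = ℕP.suc-injective len , λ i i< →
  subst₂ (λ t R → MarginalRow t R (rowAt b i) (rowAt b (suc i))) (ℕP.+-suc s i) (ℕP.+-suc s k) (rows (suc i) (s≤s i<))

buildRow≡head : ∀ css s → buildRow css s ≡ rowAt (buildTableau css s) 0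
buildRow≡head [] s = refl
buildRow≡head (cs ∷ css) s = refl

buildTableau-rowCounts : ∀ k s b → MarginalRows s k b → buildTableau (rowCounts s k b) s ≡ b
buildTableau-rowCounts zero s [] _ = refl
buildTableau-rowCounts zero s (x ∷ b) (() , _)
buildTableau-rowCounts (suc k) s [] (() , _)
buildTableau-rowCounts (suc k) s (x ∷ b) rows = cong₂ _∷_ first-row rest
  where
  rest : buildTableau (rowCounts (suc s) k b) (suc s) ≡ b
  rest = buildTableau-rowCounts k (suc s) b (MarginalRows-tail s k x b rows)
  marginal : MarginalRow s (s + suc k) x (rowAt b 0)
  marginal = subst (λ t → MarginalRow t (s + suc k) x (rowAt b 0)) (ℕP.+-identityʳ s) (proj₂ rows 0 (s≤s z≤n))
  first-row : buildRow (rowCounts s (suc k) (x ∷ b)) s ≡ x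
  first-row = sym (begin
      x
    ≡⟨ sorted≡blocks-counts (suc k) (suc s) x (proj₁ marginal) (proj₁ (proj₂ marginal)) ⟩
      blocks (suc s) (counts (suc s) (suc (suc k)) x)
    ≡⟨ cong (λ n → replicate n (suc s) ++ blocks (suc (suc s)) (counts (suc (suc s)) (suc k) x)) (proj₂ (proj₂ marginal)) ⟩
      replicate (suc (length (rowAt b 0))) (suc s) ++ blocks (suc (suc s)) (counts (suc (suc s)) (suc k) x)
    ≡⟨ cong (λ z → replicate (suc (length z)) (suc s) ++ blocks (suc (suc s)) (counts (suc (suc s)) (suc k) x))
            (sym (trans (buildRow≡head (rowCounts (suc s) k b) (suc s)) (cong (λ t → rowAt t 0) rest))) ⟩
      buildRow (rowCounts s (suc k) (x ∷ b)) s ∎)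

InTinf⇒MarginalRows : ∀ r b → InTinf r b → MarginalRows 0 r b
InTinf⇒MarginalRows r b t = nrows , λ i i< → sorted i i< , All.tabulate (bounds i i<) , marginal i i<
  where
  open InTinf t
  sorted : ∀ i → i < r → Sorted (rowAt b i)
  sorted i i< = at-sorted (rowAt b i) (rowsWeak i i<)
  bounds : ∀ i → i < r → ∀ {z} → z ∈ rowAt b i → suc i ≤ z × z ≤ suc r
  bounds i i< {z} z∈ = above-first (rowAt b i) (sorted i i<) (leftCol i i<) z∈ ,
                       proj₂ (entries (rowAt-∈ b i (subst (i <_) (sym nrows) i<)) z∈)
    where
    above-first : ∀ row → Sorted row → 0 < length row × at row 0 ≡ suc i → z ∈ row → suc i ≤ z
    above-first (_ ∷ _) _ (_ , refl) (here refl) = ℕP.≤-refl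
    above-first (_ ∷ _) (first≤ ∷ _) (_ , refl) (there z∈′) = All.lookup first≤ z∈′

tableauOf-multiplicities : ∀ r b → InTinf r b → tableauOf r (multiplicities r b) ≡ b
tableauOf-multiplicities r b t =
  trans (cong (λ css → buildTableau css 0) (staircase-rowCounts r 0 b)) (buildTableau-rowCounts r 0 b (InTinf⇒MarginalRows r b t))

box-length : ∀ B N {ns} → ns ∈ box B N → length ns ≡ N
box-length B zero (here refl) = refl
box-length B (suc N) ns∈ with ∈-cartesianProductWith⁻ _∷_ (upTo (suc B)) (box B N) ns∈
... | _ , ns′ , _ , ns′∈ , refl = cong suc (box-length B N ns′∈)

∈-box⁺ : ∀ B N ns → length ns ≡ N → All (_≤ B) ns → ns ∈ box B N
∈-box⁺ B zero [] _ _ = here refl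
∈-box⁺ B (suc N) (n ∷ ns) e (n≤B ∷ ns≤B) =
  ∈-cartesianProductWith⁺ _∷_ (∈-upTo⁺ (s≤s n≤B)) (∈-box⁺ B N ns (ℕP.suc-injective e) ns≤B)

box-unique : ∀ B N → Unique (box B N)
box-unique B zero = [] ∷ []
box-unique B (suc N) = UniqueP.cartesianProductWith⁺ _∷_ ListP.∷-injective (UniqueP.upTo⁺ (suc B)) (box-unique B N)

Unique-map⁺ : {A B : Set} (f : A → B) {xs : List A} →
  (∀ {x y} → x ∈ xs → y ∈ xs → f x ≡ f y → x ≡ y) → Unique xs → Unique (map f xs)
Unique-map⁺ f inj [] = []
Unique-map⁺ f {x ∷ xs} inj (x∉ ∷ unique) =
  All.tabulate (λ fy∈ e → let (y , y∈ , fy≡) = ∈-map⁻ f fy∈ in All.lookup x∉ y∈ (inj (here refl) (there y∈) (trans e fy≡)))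
  ∷ Unique-map⁺ f (λ x∈ y∈ → inj (there x∈) (there y∈)) unique

length-posRoots : ∀ r → length (posRoots r) ≡ triangle r
length-posRoots r = trans (cong (λ l → length (concatMap (rowRoots {r}) l)) (upTo≡range r)) (length-rows 0 r refl)
  where
  length-rows : ∀ s k → s + k ≡ r → length (concatMap (rowRoots {r}) (range s k)) ≡ triangle k
  length-rows s zero e = refl
  length-rows s (suc k) e = trans (ListP.length-++ (rowRoots {r} s))
    (cong₂ _+_ (length-rowRoots s k e) (length-rows (suc s) k (trans (sym (ℕP.+-suc s k)) e)))

lookup≤vsum : ∀ {r} (v : Vec ℕ r) p → lookup v p ≤ vsum v
lookup≤vsum (x Vec.∷ v) Fin.zero = ℕP.m≤m+n x (vsum v)
lookup≤vsum (x Vec.∷ v) (Fin.suc p) = ℕP.≤-trans (lookup≤vsum v p) (ℕP.m≤n+m (vsum v) x)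

posRoots-nonzero : ∀ r → All (λ α → 1 ≤ vsum α) (posRoots r)
posRoots-nonzero r = All.tabulate nonzero
  where
  nonzero : ∀ {α} → α ∈ posRoots r → 1 ≤ vsum α
  nonzero α∈ with ∈-concat⁻′ (map (rowRoots {r}) (upTo r)) α∈
  ... | roots , α∈roots , roots∈ with ∈-map⁻ (rowRoots {r}) roots∈
  ...   | i , i∈ , refl with ∈-map⁻ (λ q → rootVec r i (i + q)) α∈roots
  ...     | q , _ , refl = ℕP.≤-trans (ℕP.≤-reflexive (sym at-i)) (lookup≤vsum (rootVec r i (i + q)) (fromℕ< i<r))
    where
    i<r : i < r
    i<r = ∈-upTo⁻ i∈
    at-i : lookup (rootVec r i (i + q)) (fromℕ< i<r) ≡ 1
    at-i rewrite lookup-rootVec {r} i (i + q) (fromℕ< i<r) | FinP.toℕ-fromℕ< i<r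
               | ≤ᵇ-true (ℕP.≤-refl {i}) | ≤ᵇ-true (ℕP.m≤m+n i q) = refl

∈⇒≤-vsum-linComb : ∀ {r} ns (αs : List (Vec ℕ r)) → All (λ α → 1 ≤ vsum α) αs → length ns ≤ length αs →
  ∀ {n} → n ∈ ns → n ≤ vsum (linComb ns αs)
∈⇒≤-vsum-linComb (m ∷ ns) (α ∷ αs) (nz ∷ nzs) (s≤s len≤) {n} n∈ rewrite vsum-vadd (scal m α) (linComb ns αs) with n∈
... | here refl = ℕP.≤-trans (NonzeroVector.≤-vsum-scal α nz m) (ℕP.m≤m+n _ _)
... | there n∈ns = ℕP.≤-trans (∈⇒≤-vsum-linComb ns αs nzs len≤ n∈ns) (ℕP.m≤n+m _ _)

module _ (r : ℕ) (c : Vec ℕ r) where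

  private
    N = length (posRoots r)

  multiplicityLists : List (List ℕ)
  multiplicityLists = filter (λ ns → c ≟ᵥ linComb ns (posRoots r)) (box (vsum c) N)

  tableauxOfWeight : List Tableau
  tableauxOfWeight = map (tableauOf r) multiplicityLists

  private
    ∈-multiplicityLists⁻ : ∀ {ns} → ns ∈ multiplicityLists → length ns ≡ triangle r × linComb ns (posRoots r) ≡ c
    ∈-multiplicityLists⁻ ns∈ = let (ns∈box , c≡) = ∈-filter⁻ (λ ns → c ≟ᵥ linComb ns (posRoots r)) ns∈ in
      trans (box-length (vsum c) N ns∈box) (length-posRoots r) , sym c≡

  tableauxOfWeight-unique : Unique tableauxOfWeight
  tableauxOfWeight-unique = Unique-map⁺ (tableauOf r) injective
    (UniqueP.filter⁺ (λ ns → c ≟ᵥ linComb ns (posRoots r)) (box-unique (vsum c) N))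
    where
    injective : ∀ {x y} → x ∈ multiplicityLists → y ∈ multiplicityLists → tableauOf r x ≡ tableauOf r y → x ≡ y
    injective x∈ y∈ e = trans (sym (multiplicities-tableauOf r _ (proj₁ (∈-multiplicityLists⁻ x∈))))
                              (trans (cong (multiplicities r) e) (multiplicities-tableauOf r _ (proj₁ (∈-multiplicityLists⁻ y∈))))

  tableauxOfWeight-sound : All (λ b → InTinf r b × negWt r b ≡ c) tableauxOfWeight
  tableauxOfWeight-sound = AllP.map⁺ (All.tabulate λ {ns} ns∈ →
    buildTableau-InTinf r (staircase-Staircase r ns) , trans (negWt-tableauOf r ns) (proj₂ (∈-multiplicityLists⁻ ns∈)))

  tableauxOfWeight-complete : ∀ b → InTinf r b → negWt r b ≡ c → b ∈ tableauxOfWeight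
  tableauxOfWeight-complete b b∈T wt≡c = subst (_∈ tableauxOfWeight) (tableauOf-multiplicities r b b∈T) (∈-map⁺ (tableauOf r) ns∈)
    where
    ns = multiplicities r b
    linComb≡c : linComb ns (posRoots r) ≡ c
    linComb≡c = trans (sym (negWt-tableauOf r ns)) (trans (cong (negWt r) (tableauOf-multiplicities r b b∈T)) wt≡c)
    length-ns : length ns ≡ N
    length-ns = trans (length-rowCounts r 0 b) (sym (length-posRoots r))
    ns≤ : All (_≤ vsum c) ns
    ns≤ = All.tabulate (λ n∈ → subst (_ ≤_) (cong vsum linComb≡c)
                         (∈⇒≤-vsum-linComb ns (posRoots r) (posRoots-nonzero r) (ℕP.≤-reflexive length-ns) n∈))
    ns∈ : ns ∈ multiplicityLists
    ns∈ = ∈-filter⁺ (λ ns → c ≟ᵥ linComb ns (posRoots r)) (∈-box⁺ (vsum c) N ns length-ns ns≤) (sym linComb≡c)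

  lhsSeries-tableauxOfWeight : ∀ m → lhsSeries r c m ≡ sumℤ (map (λ b → polyPow oneMinusS (seg r b) m) tableauxOfWeight)
  lhsSeries-tableauxOfWeight m = begin
      lhsSeries r c m
    ≡⟨ serProd-rootFactors (posRoots r) (posRoots-nonzero r) (vsum c) c ℕP.≤-refl m ⟩
      Σℤ (box (vsum c) N) (λ ns → when (does (c ≟ᵥ linComb ns (posRoots r))) (rootCoeffProd ns m))
    ≡⟨ sym (Σℤ-filter (λ ns → c ≟ᵥ linComb ns (posRoots r)) (box (vsum c) N) (λ ns → rootCoeffProd ns m)) ⟩
      Σℤ multiplicityLists (λ ns → rootCoeffProd ns m)
    ≡⟨ Σℤ-cong∈ multiplicityLists (λ ns ns∈ → trans (rootCoeffProd≐pow ns m)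
         (cong (λ k → polyPow oneMinusS k m) (sym (seg-tableauOf r ns (ℕP.≤-reflexive (proj₁ (∈-multiplicityLists⁻ ns∈))))))) ⟩
      Σℤ multiplicityLists (λ ns → polyPow oneMinusS (seg r (tableauOf r ns)) m)
    ≡⟨ sym (Σℤ-map multiplicityLists (tableauOf r) (λ b → polyPow oneMinusS (seg r b) m)) ⟩
      sumℤ (map (λ b → polyPow oneMinusS (seg r b) m) tableauxOfWeight) ∎

theorem3p2 : (r : ℕ) → 1 ≤ r → (c : Vec ℕ r) →
    Σ (List Tableau) (λ L →
    Unique L
    × All (λ b → InTinf r b × negWt r b ≡ c) L
    × (∀ b → InTinf r b → negWt r b ≡ c → b ∈ L)
    × (∀ m → lhsSeries r c m ≡ sumℤ (map (λ b → polyPow oneMinusS (seg r b) m) L)))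
theorem3p2 r _ c =
  tableauxOfWeight r c ,
  tableauxOfWeight-unique r c ,
  tableauxOfWeight-sound r c ,
  tableauxOfWeight-complete r c ,
  lhsSeries-tableauxOfWeight r c
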